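{- A connected simple graph $G$ contains no member of $\mathcal{F}$ as an induced subgraph if and only if $G$ is an induced subgraph of one of the following: (1) $C_5$; (2) the triangular prism $K_3 \Box K_2$; (3) a complete $4$-partite graph; (4) $C_4^{\mathbf{r}}$ for some $\mathbf{r}$ with $-\mathbf{r}\in\mathbb{N}^4$; (5) $S_4^{\mathbf{r}}$ for some $\mathbf{r}$ with $-\mathbf{r}\in\mathbb{N}^4$.
   Context: $\mathcal{F}$ is the following set of 14 graphs: the fork (star $K_{1,3}$ with one edge subdivided once); the 4-pan ($C_4$ with one pendant vertex); the bull (triangle with pendant vertices attached at two distinct triangle vertices); the dart $K_1\vee(P_3+K_1)$; the path $P_5$; the co-4-pan (triangle with a path of length $2$ attached at one triangle vertex); the 3-fan $K_1\vee P_4$; the kite (the diamond $K_4-e$ with a pendant vertex attached to one of its two degree-2 vertices); $K_1\vee(K_2+3K_1)$; $2K_1\vee(K_2+2K_1)$ (the complement of diamond$+K_2$); $3K_1\vee(K_2+K_1)$ ($K_{3,3}$ plus an edge); $P_3\vee(K_2+K_1)$; $K_{1,1,1,2,2}=K_3\vee C_4$; and $K_{1,1,1,1,4}=K_4\vee 4K_1$. Here $\vee$ denotes join, $+$ disjoint union, $mK_1$ the edgeless graph on $m$ vertices. $\mathbb{N}$ denotes the positive integers. For a graph $H=(V,E)$ and $\mathbf{d}\in\mathbb{Z}^V$ with nonzero entries, $H^{\mathbf{d}}$ is obtained by replacing each vertex $u$ by a vertex set $V_u$, which is a clique of size $-\mathbf{d}_u$ if $\mathbf{d}_u<0$ and a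 stable set of size $\mathbf{d}_u$ if $\mathbf{d}_u>0$; a vertex of $V_u$ is adjacent to a vertex of $V_v$ ($u\ne v$) iff $uv\in E$. $C_4$ is the 4-cycle and $S_4$ is the star $K_{1,3}$. Thus with $-\mathbf{r}\in\mathbb{N}^4$ each vertex is replaced by a nonempty clique. -}

module Defs where

open import Data.Nat using (ℕ; _≡ᵇ_; _≤_)
open import Data.Bool using (Bool; true; false; _∧_; _∨_; not; if_then_else_)
open import Data.Fin using (Fin; toℕ)
import Data.Fin as Fin
open import Data.Integer using (ℤ; ∣_∣; _<?_; 0ℤ; _<_)
open import Data.List using (List; []; _∷_; concatMap)
open import Data.Bool.ListAction using (any)
open import Data.Product using (Σ; _×_; _,_)
open import Relation.Binary.PropositionalEquality using (_≡_)
open import Relation.Nullary.Decidable using (⌊_⌋)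
open import Function.Definitions using (Injective)
open import Relation.Nullary using (¬_)

Adj : Set → Set
Adj V = V → V → Bool

record SimpleGraph (n : ℕ) : Set where
  field
    adj    : Adj (Fin n)
    sym    : ∀ i j → adj i j ≡ adj j i
    irrefl : ∀ i → adj i i ≡ false
open SimpleGraph public

data Walk {V : Set} (A : Adj V) : V → V → Set where
  here : ∀ {u} → Walk A u u
  step : ∀ {u v w} → A u v ≡ true → Walk A v w → Walk A u w

Connected : {V : Set} → Adj V → Set
Connected {V} A = ∀ (u v : V) → Walk A u v

_⊑ᵢ_ : {V W : Set} → Adj V → Adj W → Set
_⊑ᵢ_ {V} {W} A B = Σ (V → W) λ f → Injective _≡_ _≡_ f × (∀ x y → A x y ≡ B (f x) (f y))

fromEdges : (k : ℕ) → List (ℕ × ℕ) → Adj (Fin k)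
fromEdges k es i j = any (λ { (a , b) → ((a ≡ᵇ toℕ i) ∧ (b ≡ᵇ toℕ j)) ∨ ((a ≡ᵇ toℕ j) ∧ (b ≡ᵇ toℕ i)) }) es

joinE : List ℕ → List ℕ → List (ℕ × ℕ)
joinE xs ys = concatMap (λ x → Data.List.map (λ y → (x , y)) ys) xs

infixr 5 _++_
_++_ : List (ℕ × ℕ) → List (ℕ × ℕ) → List (ℕ × ℕ)
_++_ = Data.List._++_

FinGraph : Set
FinGraph = Σ ℕ λ k → Adj (Fin k)

fork pan4 bull dart P5 coPan4 fan3 kite g9 g10 g11 g12 g13 g14 : FinGraph
-- K_{1,3} (centre 0, leaves 1,2,3) with edge 03 subdivided by 4
fork   = 5 , fromEdges 5 ((0 , 1) ∷ (0 , 2) ∷ (0 , 3) ∷ (3 , 4) ∷ [])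
-- C4 = 0123 with pendant 4 at 0
pan4   = 5 , fromEdges 5 ((0 , 1) ∷ (1 , 2) ∷ (2 , 3) ∷ (3 , 0) ∷ (0 , 4) ∷ [])
bull   = 5 , fromEdges 5 ((0 , 1) ∷ (1 , 2) ∷ (0 , 2) ∷ (0 , 3) ∷ (1 , 4) ∷ [])
-- K1 ∨ (P3 + K1): apex 0, P3 = 1-2-3, isolated 4
dart   = 5 , fromEdges 5 (joinE (0 ∷ []) (1 ∷ 2 ∷ 3 ∷ 4 ∷ []) ++ (1 , 2) ∷ (2 , 3) ∷ [])
P5     = 5 , fromEdges 5 ((0 , 1) ∷ (1 , 2) ∷ (2 , 3) ∷ (3 , 4) ∷ [])
-- triangle 012 with path 0-3-4
coPan4 = 5 , fromEdges 5 ((0 , 1) ∷ (1 , 2) ∷ (0 , 2) ∷ (0 , 3) ∷ (3 , 4) ∷ [])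
-- K1 ∨ P4: apex 0, path 1-2-3-4
fan3   = 5 , fromEdges 5 (joinE (0 ∷ []) (1 ∷ 2 ∷ 3 ∷ 4 ∷ []) ++ (1 , 2) ∷ (2 , 3) ∷ (3 , 4) ∷ [])
-- diamond on 0,1,2,3 (missing edge 03; 0,3 have degree 2), pendant 4 at 0
kite   = 5 , fromEdges 5 ((0 , 1) ∷ (0 , 2) ∷ (1 , 2) ∷ (1 , 3) ∷ (2 , 3) ∷ (0 , 4) ∷ [])
-- K1 ∨ (K2 + 3K1)
g9     = 6 , fromEdges 6 (joinE (0 ∷ []) (1 ∷ 2 ∷ 3 ∷ 4 ∷ 5 ∷ []) ++ (1 , 2) ∷ [])
-- 2K1 ∨ (K2 + 2K1)
g10    = 6 , fromEdges 6 (joinE (0 ∷ 1 ∷ []) (2 ∷ 3 ∷ 4 ∷ 5 ∷ []) ++ (2 , 3) ∷ [])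
-- 3K1 ∨ (K2 + K1)
g11    = 6 , fromEdges 6 (joinE (0 ∷ 1 ∷ 2 ∷ []) (3 ∷ 4 ∷ 5 ∷ []) ++ (3 , 4) ∷ [])
-- P3 ∨ (K2 + K1)
g12    = 6 , fromEdges 6 (joinE (0 ∷ 1 ∷ 2 ∷ []) (3 ∷ 4 ∷ 5 ∷ []) ++ (0 , 1) ∷ (1 , 2) ∷ (3 , 4) ∷ [])
-- K3 ∨ C4 = K_{1,1,1,2,2}
g13    = 7 , fromEdges 7 (joinE (0 ∷ 1 ∷ 2 ∷ []) (3 ∷ 4 ∷ 5 ∷ 6 ∷ [])
                 ++ (0 , 1) ∷ (0 , 2) ∷ (1 , 2) ∷ (3 , 4) ∷ (4 , 5) ∷ (5 , 6) ∷ (6 , 3) ∷ [])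
-- K4 ∨ 4K1 = K_{1,1,1,1,4}
g14    = 8 , fromEdges 8 (joinE (0 ∷ 1 ∷ 2 ∷ 3 ∷ []) (4 ∷ 5 ∷ 6 ∷ 7 ∷ [])
                 ++ joinE (0 ∷ []) (1 ∷ 2 ∷ 3 ∷ []) ++ joinE (1 ∷ []) (2 ∷ 3 ∷ []) ++ (2 , 3) ∷ [])

𝓕 : List FinGraph
𝓕 = fork ∷ pan4 ∷ bull ∷ dart ∷ P5 ∷ coPan4 ∷ fan3 ∷ kite ∷ g9 ∷ g10 ∷ g11 ∷ g12 ∷ g13 ∷ g14 ∷ []

C5 prism C4 S4 : Adj (Fin _)
C5    = fromEdges 5 ((0 , 1) ∷ (1 , 2) ∷ (2 , 3) ∷ (3 , 4) ∷ (4 , 0) ∷ [])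
prism = fromEdges 6 ((0 , 1) ∷ (1 , 2) ∷ (0 , 2) ∷ (3 , 4) ∷ (4 , 5) ∷ (3 , 5) ∷ (0 , 3) ∷ (1 , 4) ∷ (2 , 5) ∷ [])
C4    = fromEdges 4 ((0 , 1) ∷ (1 , 2) ∷ (2 , 3) ∷ (3 , 0) ∷ [])
S4    = fromEdges 4 ((0 , 1) ∷ (0 , 2) ∷ (0 , 3) ∷ [])

CompleteMultipartite : (k : ℕ) (s : Fin k → ℕ) → Adj (Σ (Fin k) λ i → Fin (s i))
CompleteMultipartite k s (i , _) (j , _) = not ⌊ i Fin.≟ j ⌋

-- Blow-up H^d: vertex u replaced by V_u = {u} × Fin |d_u|, a clique if d_u < 0,
-- a stable set if d_u > 0; distinct classes adjacent iff uv ∈ E(H).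
Blowup : {k : ℕ} → Adj (Fin k) → (d : Fin k → ℤ) → Adj (Σ (Fin k) λ u → Fin ∣ d u ∣)
Blowup H d (u , a) (v , b) =
  if ⌊ u Fin.≟ v ⌋
  then (⌊ d u <? 0ℤ ⌋ ∧ not (toℕ a ≡ᵇ toℕ b))
  else H u v

-- Every target is 𝓕-free: a member of 𝓕 inside a target would map to the target's skeleton
-- (C₅, the prism, K₄, or C₄ resp. S₄ with loops) so that adjacency of distinct vertices is read
-- off the skeleton, and an exhaustive search shows that no member of 𝓕 has such a map.
-- Conversely, let G be connected and 𝓕-free.  Run through a list of anchor graphs, the last of
-- which is K₁, and take the first one that G contains; G then also avoids the earlier anchors.
-- Each anchor comes with a labelling by skeleton vertices.  A vertex outside the anchor copy is
-- classified by its trace (its neighbourhood in the anchor), and a finite check shows: a nonempty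
-- trace is either listed with a label or, together with the anchor, induces a forbidden graph; a
-- vertex with a listed trace has no neighbour with empty trace, so by connectivity no trace is
-- empty; and two outside vertices are adjacent exactly as their labels prescribe, or again induce
-- a forbidden graph.  So the labels map G to the skeleton, i.e. embed G into the target.

module Submission where

open import Defs
open import Data.Nat using (ℕ; _≤_)
open import Data.Fin using (Fin)
open import Data.Integer using (ℤ; _<_; 0ℤ; ∣_∣)
open import Data.Product using (Σ; _×_; proj₁; proj₂; ∃)
open import Data.Sum using (_⊎_)
open import Data.List.Membership.Propositional using (_∈_)
open import Relation.Nullary using (¬_)
open import Function.Bundles using (_⇔_)

open import Data.Bool using (Bool; true; false; T; not; _∧_; _∨_)
open import Data.Bool.ListAction using (all; any)
open import Data.Bool.Properties using (T-∧; T-∨; T-≡; T-not-≡; T?; ∧-zeroʳ)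
  renaming (_≟_ to _≟ᵇ_)
open import Data.Empty using (⊥-elim)
open import Data.Fin using (zero; suc; _≟_; toℕ; #_)
import Data.Fin.Properties as Fin
open import Data.Integer using (-[1+_]; -<+; _<?_)
open import Data.List using (List; []; _∷_; [_]; allFin; findᵇ)
import Data.List as List
open import Data.List.Membership.Propositional using (find; lose)
open import Data.List.Membership.Propositional.Properties using (∈-allFin; ∈-++⁻)
open import Data.List.Relation.Unary.All as All using ()
open import Data.List.Relation.Unary.All.Properties using (all⁺; all⁻)
open import Data.List.Relation.Unary.Any using (here; there)
open import Data.List.Relation.Unary.Any.Properties using (any⁺; any⁻)
open import Data.Maybe using (Maybe; just; nothing)
import Data.Maybe as Maybe
open import Data.Nat using (zero; suc; _+_; _≡ᵇ_; s≤s; z≤n)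
open import Data.Nat.Properties using (≡ᵇ⇒≡; ≡⇒≡ᵇ)
open import Data.Product using (_,_; ∃₂)
open import Data.Sum using (inj₁; inj₂)
open import Data.Vec using (Vec; []; _∷_; lookup; tabulate; replicate)
import Data.Vec as Vec
open import Data.Vec.Functional as Vector using ()
open import Data.Vec.Properties using (lookup∘tabulate; lookup-replicate; ≡-dec)
open import Function using (_∘_; const)
open import Function.Bundles using (Equivalence; mk⇔)
open import Function.Definitions using (Injective)
import Relation.Binary.PropositionalEquality as ≡
open ≡ using (_≡_; _≢_; refl; trans; cong; subst; subst₂)
open import Relation.Nullary using (Dec; yes; no; ¬?; _⊎-dec_)
open import Relation.Nullary.Decidable
  using (⌊_⌋; map′; toWitness; fromWitness; toWitnessFalse; fromWitnessFalse; decidable-stable)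
open import Relation.Unary using (Decidable)

open Equivalence using (to; from)

-- Models
-- A graph has a model in H with loops (in K_k) iff it is an induced subgraph of a blow-up of H
-- into cliques (of K_k into stable sets).
Model[_] : {V W : Set} → Bool → Adj V → Adj W → (V → W) → Set
Model[_] {V} rigid A B f =
  ∀ (x y : V) → x ≢ y → A x y ≡ B (f x) (f y) × (T rigid → f x ≢ f y)

⊑ᵢ-trans : {U V W : Set} {A : Adj U} {B : Adj V} {C : Adj W} → A ⊑ᵢ B → B ⊑ᵢ C → A ⊑ᵢ C
⊑ᵢ-trans (f , f-injective , f-preserves) (g , g-injective , g-preserves) =
  g ∘ f , f-injective ∘ g-injective , λ x y → trans (f-preserves x y) (g-preserves (f x) (f y))

⊑ᵢ⇒Model : ∀ {V W : Set} {A : Adj V} {B : Adj W} rigid (e : A ⊑ᵢ B) → Model[ rigid ] A B (proj₁ e)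
⊑ᵢ⇒Model _ (f , f-injective , f-preserves) x y x≢y = f-preserves x y , λ _ → x≢y ∘ f-injective

Model-∘-⊑ᵢ : ∀ {U V W : Set} {A : Adj U} {B : Adj V} {C : Adj W} {rigid g} (e : A ⊑ᵢ B) →
             Model[ rigid ] B C g → Model[ rigid ] A C (g ∘ proj₁ e)
Model-∘-⊑ᵢ (f , f-injective , f-preserves) model x y x≢y =
  let adjacent , distinct = model (f x) (f y) (x≢y ∘ f-injective)
  in trans (f-preserves x y) adjacent , distinct

Model-read-off : ∀ {K V W : Set} {P : Adj K} {A : Adj V} {B : Adj W} {rigid L} (e : P ⊑ᵢ A) →
                 Model[ rigid ] P B L → ∀ {u v} → u ≢ v →
                 A (proj₁ e u) (proj₁ e v) ≡ B (L u) (L v) × (T rigid → L u ≢ L v)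
Model-read-off (_ , _ , preserves) model u≢v =
  let adjacent , distinct = model _ _ u≢v in trans (≡.sym (preserves _ _)) adjacent , distinct

T-all : ∀ {A : Set} {p : A → Bool} {xs x} → T (all p xs) → x ∈ xs → T (p x)
T-all {p = p} t = All.lookup (all⁺ p _ t)

T-all-allFin : ∀ {m} {p : Fin m → Bool} → T (all p (allFin m)) ⇔ (∀ i → T (p i))
T-all-allFin {m} {p} = mk⇔ (λ t i → T-all {xs = allFin m} t (∈-allFin i))
                           (λ h → all⁻ p (All.tabulate {xs = allFin m} λ {i} _ → h i))

T-any-allFin : ∀ {m} {p : Fin m → Bool} → T (any p (allFin m)) ⇔ ∃ (T ∘ p)
T-any-allFin {m} {p} = mk⇔ (λ t → let i , _ , pᵢ = find (any⁻ p (allFin m) t) in i , pᵢ)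
                           (λ (i , pᵢ) → any⁺ p (lose (∈-allFin i) pᵢ))

T-≟ᵇ : ∀ {a b : Bool} → T ⌊ a ≟ᵇ b ⌋ ⇔ a ≡ b
T-≟ᵇ = mk⇔ toWitness fromWitness

_≟ⱽ_ : ∀ {K} (t u : Vec Bool K) → Dec (t ≡ u)
_≟ⱽ_ = ≡-dec _≟ᵇ_

distinctᵇ : ∀ {k} → Bool → Fin k → Fin k → Bool
distinctᵇ rigid x y = not rigid ∨ not ⌊ x ≟ y ⌋

T-distinctᵇ : ∀ {k} {rigid} {x y : Fin k} → T (distinctᵇ rigid x y) ⇔ (T rigid → x ≢ y)
T-distinctᵇ {rigid = false} = mk⇔ (λ _ ()) (λ _ → _)
T-distinctᵇ {rigid = true}  = mk⇔ (λ t _ → toWitnessFalse t) (λ h → fromWitnessFalse (h _))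

tailAdj : ∀ {m} → Adj (Fin (suc m)) → Adj (Fin m)
tailAdj A i j = A (suc i) (suc j)

fitsᵇ : ∀ {m k} → Bool → Adj (Fin (suc m)) → Adj (Fin k) → Fin k → Fin k → Fin m → Bool
fitsᵇ rigid A B x y i = distinctᵇ rigid x y ∧ ⌊ A zero (suc i) ≟ᵇ B x y ⌋ ∧ ⌊ A (suc i) zero ≟ᵇ B y x ⌋

headFitsᵇ : ∀ {m k} → Bool → Adj (Fin (suc m)) → Adj (Fin k) → Fin k → Vec (Fin k) m → Bool
headFitsᵇ {m} rigid A B x w = all (λ i → fitsᵇ rigid A B x (lookup w i) i) (allFin m)

isModelᵇ : ∀ {m k} → Bool → Adj (Fin m) → Adj (Fin k) → Vec (Fin k) m → Bool
isModelᵇ rigid A B []      = true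
isModelᵇ rigid A B (x ∷ w) = headFitsᵇ rigid A B x w ∧ isModelᵇ rigid (tailAdj A) B w

isModelᵇ-sound : ∀ {m k} rigid (A : Adj (Fin m)) (B : Adj (Fin k)) v →
                 T (isModelᵇ rigid A B v) → Model[ rigid ] A B (lookup v)
isModelᵇ-sound rigid A B (x ∷ w) ok = model
  where
  tail-model = isModelᵇ-sound rigid (tailAdj A) B w (to T-∧ ok .proj₂)
  fits : ∀ i → T (distinctᵇ rigid x (lookup w i))
             × A zero (suc i) ≡ B x (lookup w i) × A (suc i) zero ≡ B (lookup w i) x
  fits i = let distinct , ok′ = to T-∧ (to T-all-allFin (to T-∧ ok .proj₁) i)
               forth , back   = to T-∧ ok′
           in distinct , to T-≟ᵇ forth , to T-≟ᵇ back
  model : Model[ rigid ] A B (lookup (x ∷ w))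
  model zero    zero    0≢0 = ⊥-elim (0≢0 refl)
  model zero    (suc j) _   = let distinct , forth , _ = fits j in forth , to T-distinctᵇ distinct
  model (suc i) zero    _   = let distinct , _ , back = fits i
                              in back , λ r e → to T-distinctᵇ distinct r (≡.sym e)
  model (suc i) (suc j) i≢j = tail-model i j (i≢j ∘ cong suc)

isModelᵇ-complete : ∀ {m k} rigid (A : Adj (Fin m)) (B : Adj (Fin k)) f →
                    Model[ rigid ] A B f → T (isModelᵇ rigid A B (tabulate f))
isModelᵇ-complete {zero}  rigid A B f model = _
isModelᵇ-complete {suc m} rigid A B f model = from T-∧ (from T-all-allFin fits , tail-ok)
  where
  tail-ok = isModelᵇ-complete rigid (tailAdj A) B (f ∘ suc)
              λ i j i≢j → model (suc i) (suc j) (i≢j ∘ Fin.suc-injective)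
  fits : ∀ i → T (fitsᵇ rigid A B (f zero) (lookup (tabulate (f ∘ suc)) i) i)
  fits i rewrite lookup∘tabulate (f ∘ suc) i =
    let forth , distinct = model zero (suc i) (λ ())
        back , _         = model (suc i) zero (λ ())
    in from T-∧ (from T-distinctᵇ distinct , from T-∧ (from T-≟ᵇ forth , from T-≟ᵇ back))

-- Backtracking: partial models are extended one vertex at a time, so a bad prefix prunes the search.
anyModelᵇ : ∀ {m k} → Bool → Adj (Fin m) → Adj (Fin k) → (Vec (Fin k) m → Bool) → Bool
anyModelᵇ {zero}      rigid A B c = c []
anyModelᵇ {suc m} {k} rigid A B c =
  anyModelᵇ rigid (tailAdj A) B λ w → any (λ x → headFitsᵇ rigid A B x w ∧ c (x ∷ w)) (allFin k)

anyModelᵇ-sound : ∀ {m k} rigid (A : Adj (Fin m)) (B : Adj (Fin k)) c →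
                  T (anyModelᵇ rigid A B c) → ∃ λ v → T (isModelᵇ rigid A B v) × T (c v)
anyModelᵇ-sound {zero}  rigid A B c ok = [] , _ , ok
anyModelᵇ-sound {suc m} rigid A B c ok =
  let w , w-ok , found = anyModelᵇ-sound rigid (tailAdj A) B _ ok
      x , x-ok         = to T-any-allFin found
      head-ok , c-ok   = to T-∧ x-ok
  in x ∷ w , from T-∧ (head-ok , w-ok) , c-ok

anyModelᵇ-complete : ∀ {m k} rigid (A : Adj (Fin m)) (B : Adj (Fin k)) c v →
                     T (isModelᵇ rigid A B v) → T (c v) → T (anyModelᵇ rigid A B c)
anyModelᵇ-complete rigid A B c []      _  c-ok = c-ok
anyModelᵇ-complete rigid A B c (x ∷ w) ok c-ok =
  let head-ok , w-ok = to T-∧ ok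
  in anyModelᵇ-complete rigid (tailAdj A) B _ w w-ok (from T-any-allFin (x , from T-∧ (head-ok , c-ok)))

hasModelᵇ : ∀ {m k} → Bool → Adj (Fin m) → Adj (Fin k) → Bool
hasModelᵇ rigid A B = anyModelᵇ rigid A B (const true)

Model⇒hasModelᵇ : ∀ {m k} {rigid} {A : Adj (Fin m)} {B : Adj (Fin k)} {f} →
                  Model[ rigid ] A B f → T (hasModelᵇ rigid A B)
Model⇒hasModelᵇ {rigid = rigid} {A} {B} {f} model =
  anyModelᵇ-complete rigid A B _ (tabulate f) (isModelᵇ-complete rigid A B f model) _

diagonalᵇ : ∀ {m k} → Adj (Fin m) → Adj (Fin k) → Vec (Fin k) m → Bool
diagonalᵇ {m} A B v = all (λ i → ⌊ A i i ≟ᵇ B (lookup v i) (lookup v i) ⌋) (allFin m)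

isEmbeddingᵇ : ∀ {m k} → Adj (Fin m) → Adj (Fin k) → Vec (Fin k) m → Bool
isEmbeddingᵇ A B v = isModelᵇ true A B v ∧ diagonalᵇ A B v

isEmbeddingᵇ-sound : ∀ {m k} (A : Adj (Fin m)) (B : Adj (Fin k)) v → T (isEmbeddingᵇ A B v) → A ⊑ᵢ B
isEmbeddingᵇ-sound A B v ok = lookup v , injective , preserves
  where
  model    = isModelᵇ-sound true A B v (to T-∧ ok .proj₁)
  diagonal = to T-all-allFin (to T-∧ ok .proj₂)
  injective : Injective _≡_ _≡_ (lookup v)
  injective {i} {j} e with i ≟ j
  ... | yes i≡j = i≡j
  ... | no  i≢j = ⊥-elim (model i j i≢j .proj₂ _ e)
  preserves : ∀ i j → A i j ≡ B (lookup v i) (lookup v j)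
  preserves i j with i ≟ j
  ... | yes refl = to T-≟ᵇ (diagonal i)
  ... | no  i≢j  = model i j i≢j .proj₁

isEmbeddingᵇ-complete : ∀ {m k} (A : Adj (Fin m)) (B : Adj (Fin k)) (e : A ⊑ᵢ B) →
                        T (isEmbeddingᵇ A B (tabulate (proj₁ e)))
isEmbeddingᵇ-complete A B e@(f , _ , preserves) =
  from T-∧ (isModelᵇ-complete true A B f (⊑ᵢ⇒Model {A = A} {B = B} true e) , from T-all-allFin diagonal)
  where
  diagonal : ∀ i → T ⌊ A i i ≟ᵇ B (lookup (tabulate f) i) (lookup (tabulate f) i) ⌋
  diagonal i rewrite lookup∘tabulate f i = from T-≟ᵇ (preserves i i)

_⊑ᵢ?_ : ∀ {m k} (A : Adj (Fin m)) (B : Adj (Fin k)) → Dec (A ⊑ᵢ B)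
A ⊑ᵢ? B = map′ sound complete (T? (anyModelᵇ true A B (diagonalᵇ A B)))
  where
  sound : T (anyModelᵇ true A B (diagonalᵇ A B)) → A ⊑ᵢ B
  sound ok = let v , model , diagonal = anyModelᵇ-sound true A B _ ok
             in isEmbeddingᵇ-sound A B v (from T-∧ (model , diagonal))
  complete : A ⊑ᵢ B → T (anyModelᵇ true A B (diagonalᵇ A B))
  complete e = let model , diagonal = to T-∧ (isEmbeddingᵇ-complete A B e)
               in anyModelᵇ-complete true A B _ (tabulate (proj₁ e)) model diagonal

-- Targets
Irreflexive : ∀ {V : Set} → Adj V → Set
Irreflexive A = ∀ x → A x x ≡ false

withLoops : ∀ {k} → Adj (Fin k) → Adj (Fin k)
withLoops H u v = ⌊ u ≟ v ⌋ ∨ H u v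

completeGraph : ∀ {k} → Adj (Fin k)
completeGraph u v = not ⌊ u ≟ v ⌋

Blowup-irreflexive : ∀ {k} (H : Adj (Fin k)) r → Irreflexive (Blowup H r)
Blowup-irreflexive H r (u , a) with u ≟ u
... | no u≢u = ⊥-elim (u≢u refl)
... | yes _ rewrite to T-≡ (≡⇒≡ᵇ (toℕ a) (toℕ a) refl) = ∧-zeroʳ _

Blowup-Model : ∀ {k} (H : Adj (Fin k)) r → (∀ u → r u < 0ℤ) →
               Model[ false ] (Blowup H r) (withLoops H) proj₁
Blowup-Model H r negative (u , a) (v , b) ua≢vb with u ≟ v
... | no _ = refl , λ ()
... | yes refl with toℕ a ≡ᵇ toℕ b in a≡ᵇb
...   | true  = ⊥-elim (ua≢vb (cong (u ,_) (Fin.toℕ-injective (≡ᵇ⇒≡ _ _ (from T-≡ a≡ᵇb)))))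
...   | false with r u <? 0ℤ
...     | yes _        = refl , λ ()
...     | no ¬negative = ⊥-elim (¬negative (negative u))

Model⇒⊑ᵢ-Blowup : ∀ {m k} (G : SimpleGraph (suc m)) (H : Adj (Fin k)) {L} →
                  Model[ false ] (adj G) (withLoops H) L → adj G ⊑ᵢ Blowup H (λ _ → -[1+ m ])
Model⇒⊑ᵢ-Blowup {m} G H {L} model = (λ x → L x , x) , cong proj₂ , preserves
  where
  r : Fin _ → ℤ
  r _ = -[1+ m ]
  preserves : ∀ x y → adj G x y ≡ Blowup H r (L x , x) (L y , y)
  preserves x y with x ≟ y
  ... | yes refl = trans (irrefl G x) (≡.sym (Blowup-irreflexive H r (L x , x)))
  ... | no x≢y   = trans (model x y x≢y .proj₁) (≡.sym (blowup-model (x≢y ∘ cong proj₂) .proj₁))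
    where blowup-model = Blowup-Model H r (λ _ → -<+) (L x , x) (L y , y)

CompleteMultipartite-Model : ∀ {k} s → Model[ false ] (CompleteMultipartite k s) completeGraph proj₁
CompleteMultipartite-Model s _ _ _ = refl , λ ()

Model⇒⊑ᵢ-CompleteMultipartite : ∀ {n k} (G : SimpleGraph n) {L} →
  Model[ false ] (adj G) completeGraph L → adj G ⊑ᵢ CompleteMultipartite k (λ _ → n)
Model⇒⊑ᵢ-CompleteMultipartite {n} {k} G {L} model = (λ x → L x , x) , cong proj₂ , preserves
  where
  preserves : ∀ x y → adj G x y ≡ CompleteMultipartite k (λ _ → n) (L x , x) (L y , y)
  preserves x y with x ≟ y
  ... | no x≢y   = model x y x≢y .proj₁
  ... | yes refl with L x ≟ L x
  ...   | yes _    = irrefl G x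
  ...   | no Lx≢Lx = ⊥-elim (Lx≢Lx refl)

Model⇒⊑ᵢ : ∀ {n k} (G : SimpleGraph n) {B : Adj (Fin k)} {L} →
           Irreflexive B → Model[ true ] (adj G) B L → adj G ⊑ᵢ B
Model⇒⊑ᵢ G {B} {L} B-irreflexive model = L , injective , preserves
  where
  injective : Injective _≡_ _≡_ L
  injective {x} {y} e with x ≟ y
  ... | yes x≡y = x≡y
  ... | no x≢y  = ⊥-elim (model x y x≢y .proj₂ _ e)
  preserves : ∀ x y → adj G x y ≡ B (L x) (L y)
  preserves x y with x ≟ y
  ... | yes refl = trans (irrefl G x) (≡.sym (B-irreflexive (L x)))
  ... | no x≢y   = model x y x≢y .proj₁

data Target : Set where
  pentagon trianglePrism multipartite cycleBlowup starBlowup : Target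

order : Target → ℕ
order pentagon      = 5
order trianglePrism = 6
order multipartite  = 4
order cycleBlowup   = 4
order starBlowup    = 4

skeleton : (t : Target) → Adj (Fin (order t))
skeleton pentagon      = C5
skeleton trianglePrism = prism
skeleton multipartite  = completeGraph
skeleton cycleBlowup   = withLoops C4
skeleton starBlowup    = withLoops S4

rigid : Target → Bool
rigid pentagon      = true
rigid trianglePrism = true
rigid multipartite  = false
rigid cycleBlowup   = false
rigid starBlowup    = false

InTarget : Target → ∀ {V : Set} → Adj V → Set
InTarget pentagon      A = A ⊑ᵢ C5
InTarget trianglePrism A = A ⊑ᵢ prism
InTarget multipartite  A = Σ (Fin 4 → ℕ) λ s → (∀ i → 1 ≤ s i) × (A ⊑ᵢ CompleteMultipartite 4 s)
InTarget cycleBlowup   A = Σ (Fin 4 → ℤ) λ r → (∀ i → r i < 0ℤ) × (A ⊑ᵢ Blowup C4 r)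
InTarget starBlowup    A = Σ (Fin 4 → ℤ) λ r → (∀ i → r i < 0ℤ) × (A ⊑ᵢ Blowup S4 r)

InSomeTarget : ∀ {V : Set} → Adj V → Set
InSomeTarget A = InTarget pentagon A ⊎ InTarget trianglePrism A ⊎ InTarget multipartite A
               ⊎ InTarget cycleBlowup A ⊎ InTarget starBlowup A

InSomeTarget⇒∃InTarget : ∀ {V : Set} {A : Adj V} → InSomeTarget A → ∃ λ t → InTarget t A
InSomeTarget⇒∃InTarget (inj₁ e)                      = pentagon , e
InSomeTarget⇒∃InTarget (inj₂ (inj₁ e))               = trianglePrism , e
InSomeTarget⇒∃InTarget (inj₂ (inj₂ (inj₁ e)))        = multipartite , e
InSomeTarget⇒∃InTarget (inj₂ (inj₂ (inj₂ (inj₁ e)))) = cycleBlowup , e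
InSomeTarget⇒∃InTarget (inj₂ (inj₂ (inj₂ (inj₂ e)))) = starBlowup , e

InTarget⇒InSomeTarget : ∀ t {V : Set} {A : Adj V} → InTarget t A → InSomeTarget A
InTarget⇒InSomeTarget pentagon      = inj₁
InTarget⇒InSomeTarget trianglePrism = inj₂ ∘ inj₁
InTarget⇒InSomeTarget multipartite  = inj₂ ∘ inj₂ ∘ inj₁
InTarget⇒InSomeTarget cycleBlowup   = inj₂ ∘ inj₂ ∘ inj₂ ∘ inj₁
InTarget⇒InSomeTarget starBlowup    = inj₂ ∘ inj₂ ∘ inj₂ ∘ inj₂

InTarget⇒Model : ∀ t {V : Set} {A : Adj V} → InTarget t A → ∃ λ f → Model[ rigid t ] A (skeleton t) f
InTarget⇒Model pentagon      e                  = _ , ⊑ᵢ⇒Model {B = C5} true e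
InTarget⇒Model trianglePrism e                  = _ , ⊑ᵢ⇒Model {B = prism} true e
InTarget⇒Model multipartite  (s , _ , e)        = _ , Model-∘-⊑ᵢ e (CompleteMultipartite-Model s)
InTarget⇒Model cycleBlowup   (r , negative , e) = _ , Model-∘-⊑ᵢ e (Blowup-Model C4 r negative)
InTarget⇒Model starBlowup    (r , negative , e) = _ , Model-∘-⊑ᵢ e (Blowup-Model S4 r negative)

Model⇒InTarget : ∀ t {m} (G : SimpleGraph (suc m)) {L} →
                 Model[ rigid t ] (adj G) (skeleton t) L → InTarget t (adj G)
Model⇒InTarget pentagon      G = Model⇒⊑ᵢ G {B = C5} (toWitness {a? = Fin.all? λ u → C5 u u ≟ᵇ false} _)
Model⇒InTarget trianglePrism G =
  Model⇒⊑ᵢ G {B = prism} (toWitness {a? = Fin.all? λ u → prism u u ≟ᵇ false} _)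
Model⇒InTarget multipartite  G model = _ , (λ _ → s≤s z≤n) , Model⇒⊑ᵢ-CompleteMultipartite G model
Model⇒InTarget cycleBlowup   G model = _ , (λ _ → -<+) , Model⇒⊑ᵢ-Blowup G C4 model
Model⇒InTarget starBlowup    G model = _ , (λ _ → -<+) , Model⇒⊑ᵢ-Blowup G S4 model

Free : List FinGraph → ∀ {V : Set} → Adj V → Set
Free Fs A = ∀ H → H ∈ Fs → ¬ (proj₂ H ⊑ᵢ A)

Free-⊑ᵢ : ∀ {Fs} {V W : Set} {A : Adj V} {B : Adj W} → A ⊑ᵢ B → Free Fs B → Free Fs A
Free-⊑ᵢ {B = B} e free H H∈Fs H⊑A = free H H∈Fs (⊑ᵢ-trans {C = B} H⊑A e)

Free-∷ʳ : ∀ {Fs H} {V : Set} {A : Adj V} → Free Fs A → ¬ (proj₂ H ⊑ᵢ A) → Free (Fs List.++ [ H ]) A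
Free-∷ʳ {Fs} free ¬H⊑A H′ H′∈ with ∈-++⁻ Fs H′∈
... | inj₁ H′∈Fs       = free H′ H′∈Fs
... | inj₂ (here refl) = ¬H⊑A

skeletonFreeᵇ : Target → Bool
skeletonFreeᵇ t = all (λ H → not (hasModelᵇ (rigid t) (proj₂ H) (skeleton t))) 𝓕

skeletons-free : ∀ t → T (skeletonFreeᵇ t)
skeletons-free pentagon      = _
skeletons-free trianglePrism = _
skeletons-free multipartite  = _
skeletons-free cycleBlowup   = _
skeletons-free starBlowup    = _

InTarget⇒Free : ∀ t {V : Set} {A : Adj V} → InTarget t A → Free 𝓕 A
InTarget⇒Free t inTarget H H∈𝓕 H⊑A =
  subst T (to T-not-≡ (T-all {p = noModelᵇ} {xs = 𝓕} (skeletons-free t) H∈𝓕))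
          (Model⇒hasModelᵇ {B = skeleton t} (Model-∘-⊑ᵢ {C = skeleton t} H⊑A model))
  where
  model = InTarget⇒Model t inTarget .proj₂
  noModelᵇ : FinGraph → Bool
  noModelᵇ H = not (hasModelᵇ (rigid t) (proj₂ H) (skeleton t))

InSomeTarget⇒Free : ∀ {V : Set} {A : Adj V} → InSomeTarget A → Free 𝓕 A
InSomeTarget⇒Free inSomeTarget = let t , inTarget = InSomeTarget⇒∃InTarget inSomeTarget
                                 in InTarget⇒Free t inTarget

-- Extensions and certificates
extend : ∀ {k} → Adj (Fin k) → Vec Bool k → Adj (Fin (suc k))
extend B t zero    zero    = false
extend B t zero    (suc j) = lookup t j
extend B t (suc i) zero    = lookup t i
extend B t (suc i) (suc j) = B i j

-- The vertex of trace t is 0 and that of trace t′ is 1, adjacent iff e.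
extend₂ : ∀ {k} → Adj (Fin k) → Vec Bool k → Vec Bool k → Bool → Adj (Fin (suc (suc k)))
extend₂ B t t′ e = extend (extend B t′) (e ∷ t)

trace : ∀ {n k} → SimpleGraph n → (Fin k → Fin n) → Fin n → Vec Bool k
trace G g x = tabulate λ i → adj G x (g i)

emptyTrace : ∀ {k} → Vec Bool k
emptyTrace = replicate _ false

⊑ᵢ-extend : ∀ {n k} (G : SimpleGraph n) {B : Adj (Fin k)} (e : B ⊑ᵢ adj G) {x} →
            (∀ i → proj₁ e i ≢ x) → extend B (trace G (proj₁ e) x) ⊑ᵢ adj G
⊑ᵢ-extend G {B} (g , g-injective , g-preserves) {x} outside = x Vector.∷ g , injective , preserves
  where
  injective : Injective _≡_ _≡_ (x Vector.∷ g)
  injective {zero}  {zero}  _ = refl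
  injective {zero}  {suc j} e = ⊥-elim (outside j (≡.sym e))
  injective {suc i} {zero}  e = ⊥-elim (outside i e)
  injective {suc i} {suc j} e = cong suc (g-injective e)
  preserves : ∀ i j → extend B (trace G g x) i j ≡ adj G ((x Vector.∷ g) i) ((x Vector.∷ g) j)
  preserves zero    zero    = ≡.sym (irrefl G x)
  preserves zero    (suc j) = lookup∘tabulate _ j
  preserves (suc i) zero    = trans (lookup∘tabulate _ i) (sym G x (g i))
  preserves (suc i) (suc j) = g-preserves i j

-- A certificate (h , xs) names the h-th graph of the forbidden list and the images of its vertices.
Certificate : Set
Certificate = ℕ × List ℕ

nth? : ∀ {A : Set} → List A → ℕ → Maybe A
nth? []       _       = nothing
nth? (x ∷ xs) zero    = just x
nth? (x ∷ xs) (suc h) = nth? xs h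

nth?-∈ : ∀ {A : Set} (xs : List A) h {x} → nth? xs h ≡ just x → x ∈ xs
nth?-∈ (x ∷ xs) zero    refl = here refl
nth?-∈ (x ∷ xs) (suc h) eq   = there (nth?-∈ xs h eq)

toFin? : ∀ k → ℕ → Maybe (Fin k)
toFin? zero    _       = nothing
toFin? (suc k) zero    = just zero
toFin? (suc k) (suc i) = Maybe.map suc (toFin? k i)

toVec? : ∀ k m → List ℕ → Maybe (Vec (Fin k) m)
toVec? k zero    []       = just []
toVec? k (suc m) (x ∷ xs) = Maybe.zipWith _∷_ (toFin? k x) (toVec? k m xs)
toVec? k _       _        = nothing

refutesᵇ : ∀ {k} → List FinGraph → Adj (Fin k) → Maybe Certificate → Bool
refutesᵇ Fs P nothing = false
refutesᵇ {k} Fs P (just (h , xs)) with nth? Fs h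
... | nothing = false
... | just H with toVec? k (proj₁ H) xs
...   | nothing = false
...   | just v  = isEmbeddingᵇ (proj₂ H) P v

refutesᵇ-sound : ∀ {k} Fs (P : Adj (Fin k)) c → T (refutesᵇ Fs P c) → ¬ Free Fs P
refutesᵇ-sound {k} Fs P (just (h , xs)) ok with nth? Fs h in found
... | just H with toVec? k (proj₁ H) xs
...   | just v = λ free → free H (nth?-∈ Fs h found) (isEmbeddingᵇ-sound (proj₂ H) P v ok)

certificateFor : ∀ {K} → Vec Bool K → List (Vec Bool K × Certificate) → Maybe Certificate
certificateFor t cs = Maybe.map proj₂ (findᵇ (λ c → ⌊ t ≟ⱽ proj₁ c ⌋) cs)

allVecᵇ : ∀ K → (Vec Bool K → Bool) → Bool
allVecᵇ zero    p = p []
allVecᵇ (suc K) p = allVecᵇ K (λ v → p (true ∷ v)) ∧ allVecᵇ K (λ v → p (false ∷ v))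

T-allVecᵇ : ∀ K {p} → T (allVecᵇ K p) → ∀ v → T (p v)
T-allVecᵇ zero    ok []          = ok
T-allVecᵇ (suc K) ok (true ∷ v)  = T-allVecᵇ K (to T-∧ ok .proj₁) v
T-allVecᵇ (suc K) ok (false ∷ v) = T-allVecᵇ K (to T-∧ ok .proj₂) v

-- Stages
-- Certificates for  extend₂ anchor t t′ e  are keyed by  e ∷ t ++ t′.
record Stage : Set where
  constructor stage
  field
    size          : ℕ
    anchor        : Adj (Fin (suc size))
    target        : Target
    labels        : Vec (Fin (order target)) (suc size)
    traces        : List (Vec Bool (suc size) × Fin (order target))
    certificates₁ : List (Vec Bool (suc size) × Certificate)
    certificates₂ : List (Vec Bool (suc (suc size + suc size)) × Certificate)

  anchorGraph : FinGraph
  anchorGraph = suc size , anchor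

module _ (Fs : List FinGraph) (S : Stage) where
  open Stage S

  private
    Q = skeleton target
    r = rigid target
    Trace = Vec Bool (suc size)
    Labelled = Trace × Fin (order target)

  Listed : Trace → Set
  Listed t = t ≡ emptyTrace ⊎ (∃ λ l → (t , l) ∈ traces) ⊎ ¬ Free Fs (extend anchor t)

  PairFits : Trace → Fin (order target) → Trace → Fin (order target) → Bool → Set
  PairFits t l t′ l′ e =
    Model[ r ] (extend₂ anchor t t′ e) Q (lookup (l ∷ l′ ∷ labels)) ⊎ ¬ Free Fs (extend₂ anchor t t′ e)

  record Valid : Set where
    field
      anchor-model   : Model[ r ] anchor Q (lookup labels)
      trace-listed   : ∀ t → Listed t
      trace-model    : ∀ {t l} → (t , l) ∈ traces → Model[ r ] (extend anchor t) Q (lookup (l ∷ labels))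
      trace-isolated : ∀ {t l} → (t , l) ∈ traces → ¬ Free Fs (extend₂ anchor t emptyTrace true)
      trace-pair     : ∀ {t l t′ l′} → (t , l) ∈ traces → (t′ , l′) ∈ traces → ∀ e → PairFits t l t′ l′ e

  listedᵇ : Trace → Bool
  listedᵇ t = ⌊ t ≟ⱽ emptyTrace ⌋ ∨ any (λ c → ⌊ t ≟ⱽ proj₁ c ⌋) traces
            ∨ refutesᵇ Fs (extend anchor t) (certificateFor t certificates₁)

  traceModelᵇ : Labelled → Bool
  traceModelᵇ (t , l) = isModelᵇ r (extend anchor t) Q (l ∷ labels)

  isolatedᵇ : Labelled → Bool
  isolatedᵇ (t , _) = refutesᵇ Fs (extend₂ anchor t emptyTrace true)
                               (certificateFor (true ∷ t Vec.++ emptyTrace) certificates₂)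

  pairᵇ : Labelled → Labelled → Bool → Bool
  pairᵇ (t , l) (t′ , l′) e = isModelᵇ r (extend₂ anchor t t′ e) Q (l ∷ l′ ∷ labels)
    ∨ refutesᵇ Fs (extend₂ anchor t t′ e) (certificateFor (e ∷ t Vec.++ t′) certificates₂)

  pairsWithᵇ : Labelled → Bool
  pairsWithᵇ c = all (λ c′ → pairᵇ c c′ true ∧ pairᵇ c c′ false) traces

  anchorᵇ allListedᵇ traceModelsᵇ allIsolatedᵇ pairsᵇ validᵇ : Bool
  anchorᵇ      = isModelᵇ r anchor Q labels
  allListedᵇ   = allVecᵇ (suc size) listedᵇ
  traceModelsᵇ = all traceModelᵇ traces
  allIsolatedᵇ = all isolatedᵇ traces
  pairsᵇ       = all pairsWithᵇ traces
  validᵇ       = anchorᵇ ∧ allListedᵇ ∧ traceModelsᵇ ∧ allIsolatedᵇ ∧ pairsᵇ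

  listedᵇ-sound : ∀ t → T (listedᵇ t) → Listed t
  listedᵇ-sound t ok with to (T-∨ {⌊ t ≟ⱽ emptyTrace ⌋}) ok
  ... | inj₁ empty = inj₁ (toWitness empty)
  ... | inj₂ ok′ with to (T-∨ {any (λ c → ⌊ t ≟ⱽ proj₁ c ⌋) traces}) ok′
  ...   | inj₂ refuted =
    inj₂ (inj₂ (refutesᵇ-sound Fs (extend anchor t) (certificateFor t certificates₁) refuted))
  ...   | inj₁ found with find (any⁻ _ traces found)
  ...     | (_ , l) , c∈ , t≡ rewrite toWitness t≡ = inj₂ (inj₁ (l , c∈))

  pairᵇ-sound : ∀ t l t′ l′ e → T (pairᵇ (t , l) (t′ , l′) e) → PairFits t l t′ l′ e
  pairᵇ-sound t l t′ l′ e ok with to (T-∨ {isModelᵇ r (extend₂ anchor t t′ e) Q (l ∷ l′ ∷ labels)}) ok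
  ... | inj₁ model   = inj₁ (isModelᵇ-sound r (extend₂ anchor t t′ e) Q (l ∷ l′ ∷ labels) model)
  ... | inj₂ refuted =
    inj₂ (refutesᵇ-sound Fs (extend₂ anchor t t′ e) (certificateFor (e ∷ t Vec.++ t′) certificates₂) refuted)

  validᵇ-sound : T validᵇ → Valid
  validᵇ-sound ok =
    let anchor-ok , ok      = to (T-∧ {anchorᵇ}) ok
        listed-ok , ok      = to (T-∧ {allListedᵇ}) ok
        traces-ok , ok      = to (T-∧ {traceModelsᵇ}) ok
        isolated-ok , pairs-ok = to (T-∧ {allIsolatedᵇ}) ok
    in record
    { anchor-model   = isModelᵇ-sound r anchor Q labels anchor-ok
    ; trace-listed   = λ t → listedᵇ-sound t (T-allVecᵇ (suc size) {listedᵇ} listed-ok t)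
    ; trace-model    = λ {t} {l} c∈ → isModelᵇ-sound r (extend anchor t) Q (l ∷ labels)
                                        (T-all {p = traceModelᵇ} {xs = traces} traces-ok c∈)
    ; trace-isolated = λ {t} c∈ → refutesᵇ-sound Fs (extend₂ anchor t emptyTrace true)
                                    (certificateFor (true ∷ t Vec.++ emptyTrace) certificates₂)
                                    (T-all {p = isolatedᵇ} {xs = traces} isolated-ok c∈)
    ; trace-pair     = λ {t} {l} {t′} {l′} c∈ c′∈ →
        let both = to T-∧ (T-all {xs = traces} (T-all {p = pairsWithᵇ} {xs = traces} pairs-ok c∈) c′∈)
        in λ { true  → pairᵇ-sound t l t′ l′ true  (both .proj₁)
             ; false → pairᵇ-sound t l t′ l′ false (both .proj₂) }
    }

walk-leaves : ∀ {V : Set} {A : Adj V} {P : V → Set} → Decidable P →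
              ∀ {u w} → Walk A u w → P u → ¬ P w →
              ∃₂ λ p q → P p × ¬ P q × A p q ≡ true
walk-leaves P? here Pu ¬Pw = ⊥-elim (¬Pw Pu)
walk-leaves P? (step {v = v} edge walk) Pu ¬Pw with P? v
... | yes Pv  = walk-leaves P? walk Pv ¬Pw
... | no  ¬Pv = _ , _ , Pu , ¬Pv , edge

module Labelling {n} (G : SimpleGraph n) (connected : Connected (adj G))
                 {Fs : List FinGraph} (free : Free Fs (adj G))
                 {S : Stage} (valid : Valid Fs S) (anchored : Stage.anchor S ⊑ᵢ adj G) where
  open Stage S
  open Valid valid

  a : Fin (suc size) → Fin n
  a = proj₁ anchored

  Outside : Fin n → Set
  Outside x = ∀ i → a i ≢ x

  single-⊑ᵢ : ∀ {x} → Outside x → extend anchor (trace G a x) ⊑ᵢ adj G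
  single-⊑ᵢ = ⊑ᵢ-extend G anchored

  pair-⊑ᵢ : ∀ {x y} → x ≢ y → Outside x → Outside y →
            extend₂ anchor (trace G a x) (trace G a y) (adj G x y) ⊑ᵢ adj G
  pair-⊑ᵢ {x} {y} x≢y x-outside y-outside = ⊑ᵢ-extend G (single-⊑ᵢ y-outside) outside
    where
    outside : ∀ i → (y Vector.∷ a) i ≢ x
    outside zero    = x≢y ∘ ≡.sym
    outside (suc i) = x-outside i

  not-refuted : ∀ {k} {P : Adj (Fin k)} → P ⊑ᵢ adj G → ¬ ¬ Free Fs P
  not-refuted e refuted = refuted (Free-⊑ᵢ {B = adj G} e free)

  listed : ∀ {x} → Outside x → trace G a x ≢ emptyTrace → ∃ λ l → (trace G a x , l) ∈ traces
  listed {x} outside nonempty with trace-listed (trace G a x)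
  ... | inj₁ empty         = ⊥-elim (nonempty empty)
  ... | inj₂ (inj₁ found)  = found
  ... | inj₂ (inj₂ refuted) = ⊥-elim (not-refuted (single-⊑ᵢ outside) refuted)

  Seen : Fin n → Set
  Seen x = (∃ λ i → a i ≡ x) ⊎ trace G a x ≢ emptyTrace

  seen? : Decidable Seen
  seen? x = Fin.any? (λ i → a i ≟ x) ⊎-dec ¬? (trace G a x ≟ⱽ emptyTrace)

  unseen-outside : ∀ {q} → ¬ Seen q → Outside q
  unseen-outside q-unseen i e = q-unseen (inj₁ (i , e))

  unseen-empty : ∀ {q} → ¬ Seen q → trace G a q ≡ emptyTrace
  unseen-empty {q} q-unseen = decidable-stable (trace G a q ≟ⱽ emptyTrace) (q-unseen ∘ inj₂)

  no-edge-leaves : ∀ {p q} → Seen p → ¬ Seen q → adj G p q ≢ true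
  no-edge-leaves {p} {q} p-seen q-unseen edge with Fin.any? (λ i → a i ≟ p)
  ... | yes (i , refl) = true≢false (begin
        true                   ≡⟨ ≡.sym edge ⟩
        adj G (a i) q          ≡⟨ sym G (a i) q ⟩
        adj G q (a i)          ≡⟨ ≡.sym (lookup∘tabulate (λ j → adj G q (a j)) i) ⟩
        lookup (trace G a q) i ≡⟨ cong (λ t → lookup t i) (unseen-empty q-unseen) ⟩
        lookup emptyTrace i    ≡⟨ lookup-replicate i false ⟩
        false                  ∎)
    where
    open ≡.≡-Reasoning
    true≢false : true ≢ false
    true≢false ()
  ... | no ¬p-anchored with p-seen
  ...   | inj₁ p-anchored = ¬p-anchored p-anchored
  ...   | inj₂ nonempty   = not-refuted isolated-⊑ᵢ (trace-isolated (listed p-outside nonempty .proj₂))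
    where
    p-outside : Outside p
    p-outside i e = ¬p-anchored (i , e)
    isolated-⊑ᵢ : extend₂ anchor (trace G a p) emptyTrace true ⊑ᵢ adj G
    isolated-⊑ᵢ = subst₂ (λ t e → extend₂ anchor (trace G a p) t e ⊑ᵢ adj G)
                         (unseen-empty q-unseen) edge
                         (pair-⊑ᵢ (λ { refl → q-unseen p-seen }) p-outside (unseen-outside q-unseen))

  all-seen : ∀ x → Seen x
  all-seen x with seen? x
  ... | yes x-seen  = x-seen
  ... | no x-unseen =
    let _ , _ , p-seen , q-unseen , edge =
          walk-leaves seen? (connected (a zero) x) (inj₁ (zero , refl)) x-unseen
    in ⊥-elim (no-edge-leaves p-seen q-unseen edge)

  data Position (x : Fin n) : Set where
    anchor-vertex  : ∀ i → a i ≡ x → Position x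
    outside-vertex : Outside x → ∀ l → (trace G a x , l) ∈ traces → Position x

  position : ∀ x → Position x
  position x with all-seen x
  ... | inj₁ (i , e) = anchor-vertex i e
  ... | inj₂ nonempty with Fin.any? (λ i → a i ≟ x)
  ...   | yes (i , e)  = anchor-vertex i e
  ...   | no ¬anchored = let l , c∈ = listed outside nonempty in outside-vertex outside l c∈
    where
    outside : Outside x
    outside i e = ¬anchored (i , e)

  labelOf : ∀ {x} → Position x → Fin (order target)
  labelOf (anchor-vertex i _)    = lookup labels i
  labelOf (outside-vertex _ l _) = l

  label : Fin n → Fin (order target)
  label x = labelOf (position x)

  read-off : ∀ {k} {P : Adj (Fin k)} {L} (e : P ⊑ᵢ adj G) → Model[ rigid target ] P (skeleton target) L →
             ∀ {u v} → u ≢ v →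
             adj G (proj₁ e u) (proj₁ e v) ≡ skeleton target (L u) (L v) × (T (rigid target) → L u ≢ L v)
  read-off = Model-read-off {A = adj G} {B = skeleton target}

  labelOf-model : ∀ {x y} (px : Position x) (py : Position y) → x ≢ y →
    adj G x y ≡ skeleton target (labelOf px) (labelOf py) × (T (rigid target) → labelOf px ≢ labelOf py)
  labelOf-model (anchor-vertex i refl) (anchor-vertex j refl) x≢y =
    read-off anchored anchor-model (x≢y ∘ cong a)
  labelOf-model (anchor-vertex i refl) (outside-vertex y-outside l c∈) _ =
    read-off (single-⊑ᵢ y-outside) (trace-model c∈) {suc i} {zero} λ ()
  labelOf-model (outside-vertex x-outside l c∈) (anchor-vertex j refl) _ =
    read-off (single-⊑ᵢ x-outside) (trace-model c∈) {zero} {suc j} λ ()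
  labelOf-model {x} {y} (outside-vertex x-outside l c∈) (outside-vertex y-outside l′ c′∈) x≢y
    with trace-pair c∈ c′∈ (adj G x y)
  ... | inj₁ model   = read-off (pair-⊑ᵢ x≢y x-outside y-outside) model {zero} {suc zero} λ ()
  ... | inj₂ refuted = ⊥-elim (not-refuted (pair-⊑ᵢ x≢y x-outside y-outside) refuted)

  label-model : Model[ rigid target ] (adj G) (skeleton target) label
  label-model x y = labelOf-model (position x) (position y)

isK₁ᵇ : FinGraph → Bool
isK₁ᵇ (suc zero , A) = not (A zero zero)
isK₁ᵇ _              = false

isK₁ᵇ-⊑ᵢ : ∀ {m} (G : SimpleGraph (suc m)) H → T (isK₁ᵇ H) → proj₂ H ⊑ᵢ adj G
isK₁ᵇ-⊑ᵢ G (suc zero , A) ok =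
  (λ _ → zero) , (λ { {zero} {zero} _ → refl }) ,
  λ { zero zero → trans (to T-not-≡ ok) (≡.sym (irrefl G zero)) }

-- Each stage is checked against 𝓕 and the anchors of the earlier stages; once all anchors are
-- forbidden, a one-vertex graph is forbidden, which no nonempty graph avoids.
stagesValidᵇ : List FinGraph → List Stage → Bool
stagesValidᵇ Fs []       = any isK₁ᵇ Fs
stagesValidᵇ Fs (S ∷ Ss) = validᵇ Fs S ∧ stagesValidᵇ (Fs List.++ [ Stage.anchorGraph S ]) Ss

Classified : ∀ {m} → SimpleGraph m → Set
Classified G = ∃₂ λ t L → Model[ rigid t ] (adj G) (skeleton t) L

classify : ∀ {m} (G : SimpleGraph (suc m)) → Connected (adj G) → ∀ Fs Ss →
           T (stagesValidᵇ Fs Ss) → Free Fs (adj G) → Classified G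
classify G connected Fs [] ok free =
  let H , H∈Fs , H-K₁ = find (any⁻ isK₁ᵇ Fs ok) in ⊥-elim (free H H∈Fs (isK₁ᵇ-⊑ᵢ G H H-K₁))
classify G connected Fs (S ∷ Ss) ok free = continue (Stage.anchor S ⊑ᵢ? adj G)
  where
  this-ok  = to (T-∧ {validᵇ Fs S}) ok .proj₁
  later-ok = to (T-∧ {validᵇ Fs S}) ok .proj₂
  continue : Dec (Stage.anchor S ⊑ᵢ adj G) → Classified G
  continue (yes anchored) = _ , _ , Labelling.label-model G connected free (validᵇ-sound Fs S this-ok) anchored
  continue (no ¬anchored) = classify G connected _ Ss later-ok (Free-∷ʳ {A = adj G} free ¬anchored)

-- Stage data
-- Certificate index h < 14 refers to 𝓕, index 14 + i to the anchor of stage i.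

stage₀ : Stage
stage₀ = stage 4 (fromEdges 5 ((0 , 3) ∷ (0 , 4) ∷ (1 , 2) ∷ (1 , 4) ∷ (2 , 3) ∷ (3 , 4) ∷ [])) trianglePrism
  (# 0 ∷ # 4 ∷ # 5 ∷ # 2 ∷ # 1 ∷ [])
  ( (true ∷ true ∷ true ∷ false ∷ false ∷ [] , # 3)
  ∷ [])
  ( (false ∷ false ∷ false ∷ false ∷ true ∷ [] , 0 , 5 ∷ 0 ∷ 1 ∷ 2 ∷ 3 ∷ [])
  ∷ (false ∷ false ∷ false ∷ true ∷ false ∷ [] , 0 , 4 ∷ 0 ∷ 1 ∷ 3 ∷ 2 ∷ [])
  ∷ (false ∷ false ∷ false ∷ true ∷ true ∷ [] , 0 , 4 ∷ 0 ∷ 1 ∷ 3 ∷ 2 ∷ [])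
  ∷ (false ∷ false ∷ true ∷ false ∷ false ∷ [] , 0 , 3 ∷ 0 ∷ 2 ∷ 4 ∷ 1 ∷ [])
  ∷ (false ∷ false ∷ true ∷ false ∷ true ∷ [] , 0 , 3 ∷ 0 ∷ 2 ∷ 4 ∷ 1 ∷ [])
  ∷ (false ∷ false ∷ true ∷ true ∷ false ∷ [] , 2 , 3 ∷ 4 ∷ 0 ∷ 2 ∷ 1 ∷ [])
  ∷ (false ∷ false ∷ true ∷ true ∷ true ∷ [] , 1 , 5 ∷ 0 ∷ 3 ∷ 2 ∷ 1 ∷ [])
  ∷ (false ∷ true ∷ false ∷ false ∷ false ∷ [] , 0 , 2 ∷ 0 ∷ 3 ∷ 5 ∷ 1 ∷ [])
  ∷ (false ∷ true ∷ false ∷ false ∷ true ∷ [] , 2 , 2 ∷ 5 ∷ 0 ∷ 3 ∷ 1 ∷ [])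
  ∷ (false ∷ true ∷ false ∷ true ∷ false ∷ [] , 0 , 2 ∷ 0 ∷ 3 ∷ 5 ∷ 1 ∷ [])
  ∷ (false ∷ true ∷ false ∷ true ∷ true ∷ [] , 1 , 4 ∷ 0 ∷ 2 ∷ 3 ∷ 1 ∷ [])
  ∷ (false ∷ true ∷ true ∷ false ∷ false ∷ [] , 5 , 2 ∷ 0 ∷ 3 ∷ 5 ∷ 1 ∷ [])
  ∷ (false ∷ true ∷ true ∷ false ∷ true ∷ [] , 5 , 3 ∷ 0 ∷ 2 ∷ 4 ∷ 1 ∷ [])
  ∷ (false ∷ true ∷ true ∷ true ∷ false ∷ [] , 5 , 2 ∷ 0 ∷ 3 ∷ 5 ∷ 1 ∷ [])
  ∷ (false ∷ true ∷ true ∷ true ∷ true ∷ [] , 6 , 4 ∷ 1 ∷ 5 ∷ 0 ∷ 3 ∷ [])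
  ∷ (true ∷ false ∷ false ∷ false ∷ false ∷ [] , 2 , 1 ∷ 4 ∷ 5 ∷ 0 ∷ 3 ∷ [])
  ∷ (true ∷ false ∷ false ∷ false ∷ true ∷ [] , 1 , 5 ∷ 2 ∷ 3 ∷ 4 ∷ 0 ∷ [])
  ∷ (true ∷ false ∷ false ∷ true ∷ false ∷ [] , 1 , 4 ∷ 3 ∷ 2 ∷ 5 ∷ 0 ∷ [])
  ∷ (true ∷ false ∷ false ∷ true ∷ true ∷ [] , 5 , 4 ∷ 0 ∷ 1 ∷ 3 ∷ 2 ∷ [])
  ∷ (true ∷ false ∷ true ∷ false ∷ false ∷ [] , 1 , 3 ∷ 0 ∷ 1 ∷ 4 ∷ 2 ∷ [])
  ∷ (true ∷ false ∷ true ∷ false ∷ true ∷ [] , 1 , 3 ∷ 0 ∷ 1 ∷ 4 ∷ 2 ∷ [])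
  ∷ (true ∷ false ∷ true ∷ true ∷ false ∷ [] , 6 , 4 ∷ 3 ∷ 0 ∷ 1 ∷ 5 ∷ [])
  ∷ (true ∷ false ∷ true ∷ true ∷ true ∷ [] , 7 , 3 ∷ 0 ∷ 4 ∷ 1 ∷ 2 ∷ [])
  ∷ (true ∷ true ∷ false ∷ false ∷ false ∷ [] , 1 , 2 ∷ 0 ∷ 1 ∷ 5 ∷ 3 ∷ [])
  ∷ (true ∷ true ∷ false ∷ false ∷ true ∷ [] , 6 , 5 ∷ 2 ∷ 0 ∷ 1 ∷ 4 ∷ [])
  ∷ (true ∷ true ∷ false ∷ true ∷ false ∷ [] , 1 , 2 ∷ 0 ∷ 1 ∷ 5 ∷ 3 ∷ [])
  ∷ (true ∷ true ∷ false ∷ true ∷ true ∷ [] , 7 , 2 ∷ 0 ∷ 5 ∷ 1 ∷ 3 ∷ [])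
  ∷ (true ∷ true ∷ true ∷ false ∷ true ∷ [] , 6 , 0 ∷ 1 ∷ 5 ∷ 2 ∷ 3 ∷ [])
  ∷ (true ∷ true ∷ true ∷ true ∷ false ∷ [] , 6 , 0 ∷ 1 ∷ 4 ∷ 3 ∷ 2 ∷ [])
  ∷ (true ∷ true ∷ true ∷ true ∷ true ∷ [] , 6 , 0 ∷ 1 ∷ 4 ∷ 3 ∷ 2 ∷ [])
  ∷ [])
  ( (true ∷ true ∷ true ∷ true ∷ false ∷ false ∷ false ∷ false ∷ false ∷ false ∷ false ∷ [] , 0 , 0 ∷ 1 ∷ 3 ∷ 2 ∷ 5 ∷ [])
  ∷ (true ∷ true ∷ true ∷ true ∷ false ∷ false ∷ true ∷ true ∷ true ∷ false ∷ false ∷ [] , 5 , 3 ∷ 0 ∷ 1 ∷ 6 ∷ 5 ∷ [])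
  ∷ (false ∷ true ∷ true ∷ true ∷ false ∷ false ∷ true ∷ true ∷ true ∷ false ∷ false ∷ [] , 0 , 3 ∷ 0 ∷ 1 ∷ 6 ∷ 5 ∷ [])
  ∷ [])

stage₁ : Stage
stage₁ = stage 4 (fromEdges 5 ((0 , 4) ∷ (1 , 4) ∷ (2 , 3) ∷ (2 , 4) ∷ (3 , 4) ∷ [])) starBlowup
  (# 1 ∷ # 2 ∷ # 3 ∷ # 3 ∷ # 0 ∷ [])
  ( (false ∷ false ∷ true ∷ true ∷ true ∷ [] , # 3)
  ∷ (false ∷ true ∷ false ∷ false ∷ true ∷ [] , # 2)
  ∷ (true ∷ false ∷ false ∷ false ∷ true ∷ [] , # 1)
  ∷ (true ∷ true ∷ true ∷ true ∷ true ∷ [] , # 0)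
  ∷ [])
  ( (false ∷ false ∷ false ∷ false ∷ true ∷ [] , 8 , 5 ∷ 3 ∷ 4 ∷ 0 ∷ 1 ∷ 2 ∷ [])
  ∷ (false ∷ false ∷ false ∷ true ∷ false ∷ [] , 0 , 5 ∷ 1 ∷ 2 ∷ 4 ∷ 0 ∷ [])
  ∷ (false ∷ false ∷ false ∷ true ∷ true ∷ [] , 3 , 5 ∷ 0 ∷ 4 ∷ 3 ∷ 1 ∷ [])
  ∷ (false ∷ false ∷ true ∷ false ∷ false ∷ [] , 0 , 5 ∷ 1 ∷ 2 ∷ 3 ∷ 0 ∷ [])
  ∷ (false ∷ false ∷ true ∷ false ∷ true ∷ [] , 3 , 5 ∷ 0 ∷ 3 ∷ 4 ∷ 1 ∷ [])
  ∷ (false ∷ false ∷ true ∷ true ∷ false ∷ [] , 0 , 5 ∷ 1 ∷ 2 ∷ 3 ∷ 0 ∷ [])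
  ∷ (false ∷ true ∷ false ∷ false ∷ false ∷ [] , 0 , 5 ∷ 1 ∷ 3 ∷ 2 ∷ 0 ∷ [])
  ∷ (false ∷ true ∷ false ∷ true ∷ false ∷ [] , 0 , 5 ∷ 1 ∷ 3 ∷ 2 ∷ 0 ∷ [])
  ∷ (false ∷ true ∷ false ∷ true ∷ true ∷ [] , 3 , 5 ∷ 0 ∷ 4 ∷ 3 ∷ 1 ∷ [])
  ∷ (false ∷ true ∷ true ∷ false ∷ false ∷ [] , 0 , 5 ∷ 1 ∷ 4 ∷ 2 ∷ 0 ∷ [])
  ∷ (false ∷ true ∷ true ∷ false ∷ true ∷ [] , 3 , 5 ∷ 0 ∷ 3 ∷ 4 ∷ 1 ∷ [])
  ∷ (false ∷ true ∷ true ∷ true ∷ false ∷ [] , 1 , 5 ∷ 2 ∷ 0 ∷ 3 ∷ 1 ∷ [])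
  ∷ (false ∷ true ∷ true ∷ true ∷ true ∷ [] , 3 , 5 ∷ 2 ∷ 0 ∷ 3 ∷ 1 ∷ [])
  ∷ (true ∷ false ∷ false ∷ false ∷ false ∷ [] , 0 , 5 ∷ 2 ∷ 3 ∷ 1 ∷ 0 ∷ [])
  ∷ (true ∷ false ∷ false ∷ true ∷ false ∷ [] , 0 , 5 ∷ 2 ∷ 3 ∷ 1 ∷ 0 ∷ [])
  ∷ (true ∷ false ∷ false ∷ true ∷ true ∷ [] , 3 , 5 ∷ 0 ∷ 4 ∷ 3 ∷ 2 ∷ [])
  ∷ (true ∷ false ∷ true ∷ false ∷ false ∷ [] , 0 , 5 ∷ 2 ∷ 4 ∷ 1 ∷ 0 ∷ [])
  ∷ (true ∷ false ∷ true ∷ false ∷ true ∷ [] , 3 , 5 ∷ 0 ∷ 3 ∷ 4 ∷ 2 ∷ [])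
  ∷ (true ∷ false ∷ true ∷ true ∷ false ∷ [] , 1 , 5 ∷ 1 ∷ 0 ∷ 3 ∷ 2 ∷ [])
  ∷ (true ∷ false ∷ true ∷ true ∷ true ∷ [] , 3 , 5 ∷ 1 ∷ 0 ∷ 3 ∷ 2 ∷ [])
  ∷ (true ∷ true ∷ false ∷ false ∷ false ∷ [] , 1 , 5 ∷ 1 ∷ 0 ∷ 2 ∷ 3 ∷ [])
  ∷ (true ∷ true ∷ false ∷ false ∷ true ∷ [] , 3 , 5 ∷ 1 ∷ 0 ∷ 2 ∷ 3 ∷ [])
  ∷ (true ∷ true ∷ false ∷ true ∷ false ∷ [] , 0 , 0 ∷ 1 ∷ 2 ∷ 4 ∷ 3 ∷ [])
  ∷ (true ∷ true ∷ false ∷ true ∷ true ∷ [] , 0 , 0 ∷ 1 ∷ 2 ∷ 4 ∷ 3 ∷ [])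
  ∷ (true ∷ true ∷ true ∷ false ∷ false ∷ [] , 0 , 0 ∷ 1 ∷ 2 ∷ 3 ∷ 4 ∷ [])
  ∷ (true ∷ true ∷ true ∷ false ∷ true ∷ [] , 0 , 0 ∷ 1 ∷ 2 ∷ 3 ∷ 4 ∷ [])
  ∷ (true ∷ true ∷ true ∷ true ∷ false ∷ [] , 9 , 0 ∷ 5 ∷ 3 ∷ 4 ∷ 1 ∷ 2 ∷ [])
  ∷ [])
  ( (true ∷ false ∷ false ∷ true ∷ true ∷ true ∷ false ∷ false ∷ false ∷ false ∷ false ∷ [] , 0 , 6 ∷ 2 ∷ 3 ∷ 0 ∷ 1 ∷ [])
  ∷ (true ∷ false ∷ true ∷ false ∷ false ∷ true ∷ false ∷ false ∷ false ∷ false ∷ false ∷ [] , 0 , 6 ∷ 2 ∷ 4 ∷ 0 ∷ 1 ∷ [])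
  ∷ (true ∷ true ∷ false ∷ false ∷ false ∷ true ∷ false ∷ false ∷ false ∷ false ∷ false ∷ [] , 0 , 6 ∷ 3 ∷ 4 ∷ 0 ∷ 1 ∷ [])
  ∷ (true ∷ true ∷ true ∷ true ∷ true ∷ true ∷ false ∷ false ∷ false ∷ false ∷ false ∷ [] , 3 , 0 ∷ 2 ∷ 6 ∷ 3 ∷ 1 ∷ [])
  ∷ (false ∷ false ∷ false ∷ true ∷ true ∷ true ∷ false ∷ false ∷ true ∷ true ∷ true ∷ [] , 3 , 6 ∷ 0 ∷ 4 ∷ 1 ∷ 2 ∷ [])
  ∷ (true ∷ false ∷ false ∷ true ∷ true ∷ true ∷ false ∷ true ∷ false ∷ false ∷ true ∷ [] , 3 , 6 ∷ 0 ∷ 1 ∷ 3 ∷ 2 ∷ [])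
  ∷ (true ∷ false ∷ false ∷ true ∷ true ∷ true ∷ true ∷ false ∷ false ∷ false ∷ true ∷ [] , 3 , 6 ∷ 0 ∷ 1 ∷ 2 ∷ 3 ∷ [])
  ∷ (false ∷ false ∷ false ∷ true ∷ true ∷ true ∷ true ∷ true ∷ true ∷ true ∷ true ∷ [] , 0 , 1 ∷ 2 ∷ 3 ∷ 4 ∷ 0 ∷ [])
  ∷ (true ∷ false ∷ true ∷ false ∷ false ∷ true ∷ false ∷ false ∷ true ∷ true ∷ true ∷ [] , 3 , 6 ∷ 0 ∷ 1 ∷ 4 ∷ 2 ∷ [])
  ∷ (false ∷ false ∷ true ∷ false ∷ false ∷ true ∷ false ∷ true ∷ false ∷ false ∷ true ∷ [] , 3 , 6 ∷ 0 ∷ 3 ∷ 1 ∷ 2 ∷ [])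
  ∷ (true ∷ false ∷ true ∷ false ∷ false ∷ true ∷ true ∷ false ∷ false ∷ false ∷ true ∷ [] , 3 , 6 ∷ 0 ∷ 1 ∷ 2 ∷ 4 ∷ [])
  ∷ (false ∷ false ∷ true ∷ false ∷ false ∷ true ∷ true ∷ true ∷ true ∷ true ∷ true ∷ [] , 0 , 1 ∷ 2 ∷ 4 ∷ 3 ∷ 0 ∷ [])
  ∷ (true ∷ true ∷ false ∷ false ∷ false ∷ true ∷ false ∷ false ∷ true ∷ true ∷ true ∷ [] , 3 , 6 ∷ 0 ∷ 1 ∷ 4 ∷ 3 ∷ [])
  ∷ (true ∷ true ∷ false ∷ false ∷ false ∷ true ∷ false ∷ true ∷ false ∷ false ∷ true ∷ [] , 3 , 6 ∷ 0 ∷ 1 ∷ 3 ∷ 4 ∷ [])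
  ∷ (false ∷ true ∷ false ∷ false ∷ false ∷ true ∷ true ∷ false ∷ false ∷ false ∷ true ∷ [] , 3 , 6 ∷ 0 ∷ 2 ∷ 1 ∷ 3 ∷ [])
  ∷ (false ∷ true ∷ false ∷ false ∷ false ∷ true ∷ true ∷ true ∷ true ∷ true ∷ true ∷ [] , 0 , 1 ∷ 3 ∷ 4 ∷ 2 ∷ 0 ∷ [])
  ∷ (false ∷ true ∷ true ∷ true ∷ true ∷ true ∷ false ∷ false ∷ true ∷ true ∷ true ∷ [] , 0 , 0 ∷ 2 ∷ 3 ∷ 4 ∷ 1 ∷ [])
  ∷ (false ∷ true ∷ true ∷ true ∷ true ∷ true ∷ false ∷ true ∷ false ∷ false ∷ true ∷ [] , 0 , 0 ∷ 2 ∷ 4 ∷ 3 ∷ 1 ∷ [])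
  ∷ (false ∷ true ∷ true ∷ true ∷ true ∷ true ∷ true ∷ false ∷ false ∷ false ∷ true ∷ [] , 0 , 0 ∷ 3 ∷ 4 ∷ 2 ∷ 1 ∷ [])
  ∷ (false ∷ true ∷ true ∷ true ∷ true ∷ true ∷ true ∷ true ∷ true ∷ true ∷ true ∷ [] , 9 , 0 ∷ 1 ∷ 4 ∷ 5 ∷ 2 ∷ 3 ∷ [])
  ∷ [])

stage₂ : Stage
stage₂ = stage 4 (fromEdges 5 ((0 , 3) ∷ (0 , 4) ∷ (1 , 2) ∷ (1 , 3) ∷ (1 , 4) ∷ (2 , 3) ∷ (2 , 4) ∷ (3 , 4) ∷ [])) cycleBlowup
  (# 0 ∷ # 2 ∷ # 2 ∷ # 1 ∷ # 1 ∷ [])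
  ( (false ∷ true ∷ true ∷ true ∷ true ∷ [] , # 2)
  ∷ (true ∷ false ∷ false ∷ true ∷ true ∷ [] , # 0)
  ∷ (true ∷ true ∷ true ∷ false ∷ false ∷ [] , # 3)
  ∷ (true ∷ true ∷ true ∷ true ∷ true ∷ [] , # 1)
  ∷ [])
  ( (false ∷ false ∷ false ∷ false ∷ true ∷ [] , 3 , 5 ∷ 1 ∷ 4 ∷ 2 ∷ 0 ∷ [])
  ∷ (false ∷ false ∷ false ∷ true ∷ false ∷ [] , 3 , 4 ∷ 1 ∷ 5 ∷ 2 ∷ 0 ∷ [])
  ∷ (false ∷ false ∷ false ∷ true ∷ true ∷ [] , 15 , 0 ∷ 1 ∷ 2 ∷ 3 ∷ 4 ∷ [])
  ∷ (false ∷ false ∷ true ∷ false ∷ false ∷ [] , 2 , 3 ∷ 4 ∷ 2 ∷ 0 ∷ 1 ∷ [])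
  ∷ (false ∷ false ∷ true ∷ false ∷ true ∷ [] , 2 , 3 ∷ 4 ∷ 2 ∷ 0 ∷ 1 ∷ [])
  ∷ (false ∷ false ∷ true ∷ true ∷ false ∷ [] , 2 , 3 ∷ 5 ∷ 2 ∷ 0 ∷ 1 ∷ [])
  ∷ (false ∷ false ∷ true ∷ true ∷ true ∷ [] , 3 , 4 ∷ 0 ∷ 3 ∷ 2 ∷ 1 ∷ [])
  ∷ (false ∷ true ∷ false ∷ false ∷ false ∷ [] , 2 , 2 ∷ 4 ∷ 3 ∷ 0 ∷ 1 ∷ [])
  ∷ (false ∷ true ∷ false ∷ false ∷ true ∷ [] , 2 , 2 ∷ 4 ∷ 3 ∷ 0 ∷ 1 ∷ [])
  ∷ (false ∷ true ∷ false ∷ true ∷ false ∷ [] , 2 , 2 ∷ 5 ∷ 3 ∷ 0 ∷ 1 ∷ [])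
  ∷ (false ∷ true ∷ false ∷ true ∷ true ∷ [] , 3 , 4 ∷ 0 ∷ 2 ∷ 3 ∷ 1 ∷ [])
  ∷ (false ∷ true ∷ true ∷ false ∷ false ∷ [] , 7 , 2 ∷ 4 ∷ 5 ∷ 1 ∷ 0 ∷ [])
  ∷ (false ∷ true ∷ true ∷ false ∷ true ∷ [] , 6 , 5 ∷ 0 ∷ 2 ∷ 4 ∷ 1 ∷ [])
  ∷ (false ∷ true ∷ true ∷ true ∷ false ∷ [] , 6 , 4 ∷ 0 ∷ 2 ∷ 5 ∷ 1 ∷ [])
  ∷ (true ∷ false ∷ false ∷ false ∷ false ∷ [] , 5 , 4 ∷ 2 ∷ 3 ∷ 1 ∷ 0 ∷ [])
  ∷ (true ∷ false ∷ false ∷ false ∷ true ∷ [] , 5 , 4 ∷ 2 ∷ 3 ∷ 1 ∷ 0 ∷ [])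
  ∷ (true ∷ false ∷ false ∷ true ∷ false ∷ [] , 5 , 5 ∷ 2 ∷ 3 ∷ 1 ∷ 0 ∷ [])
  ∷ (true ∷ false ∷ true ∷ false ∷ false ∷ [] , 7 , 1 ∷ 4 ∷ 5 ∷ 2 ∷ 0 ∷ [])
  ∷ (true ∷ false ∷ true ∷ false ∷ true ∷ [] , 6 , 5 ∷ 0 ∷ 1 ∷ 4 ∷ 2 ∷ [])
  ∷ (true ∷ false ∷ true ∷ true ∷ false ∷ [] , 6 , 4 ∷ 0 ∷ 1 ∷ 5 ∷ 2 ∷ [])
  ∷ (true ∷ false ∷ true ∷ true ∷ true ∷ [] , 6 , 4 ∷ 1 ∷ 0 ∷ 3 ∷ 2 ∷ [])
  ∷ (true ∷ true ∷ false ∷ false ∷ false ∷ [] , 7 , 1 ∷ 4 ∷ 5 ∷ 3 ∷ 0 ∷ [])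
  ∷ (true ∷ true ∷ false ∷ false ∷ true ∷ [] , 6 , 5 ∷ 0 ∷ 1 ∷ 4 ∷ 3 ∷ [])
  ∷ (true ∷ true ∷ false ∷ true ∷ false ∷ [] , 6 , 4 ∷ 0 ∷ 1 ∷ 5 ∷ 3 ∷ [])
  ∷ (true ∷ true ∷ false ∷ true ∷ true ∷ [] , 6 , 4 ∷ 1 ∷ 0 ∷ 2 ∷ 3 ∷ [])
  ∷ (true ∷ true ∷ true ∷ false ∷ true ∷ [] , 11 , 0 ∷ 5 ∷ 4 ∷ 2 ∷ 3 ∷ 1 ∷ [])
  ∷ (true ∷ true ∷ true ∷ true ∷ false ∷ [] , 11 , 0 ∷ 4 ∷ 5 ∷ 2 ∷ 3 ∷ 1 ∷ [])
  ∷ [])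
  ( (true ∷ false ∷ true ∷ true ∷ true ∷ true ∷ false ∷ false ∷ false ∷ false ∷ false ∷ [] , 2 , 0 ∷ 5 ∷ 3 ∷ 1 ∷ 2 ∷ [])
  ∷ (true ∷ true ∷ false ∷ false ∷ true ∷ true ∷ false ∷ false ∷ false ∷ false ∷ false ∷ [] , 2 , 0 ∷ 5 ∷ 2 ∷ 1 ∷ 3 ∷ [])
  ∷ (true ∷ true ∷ true ∷ true ∷ false ∷ false ∷ false ∷ false ∷ false ∷ false ∷ false ∷ [] , 1 , 0 ∷ 2 ∷ 5 ∷ 3 ∷ 1 ∷ [])
  ∷ (true ∷ true ∷ true ∷ true ∷ true ∷ true ∷ false ∷ false ∷ false ∷ false ∷ false ∷ [] , 3 , 0 ∷ 2 ∷ 5 ∷ 3 ∷ 1 ∷ [])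
  ∷ (false ∷ false ∷ true ∷ true ∷ true ∷ true ∷ false ∷ true ∷ true ∷ true ∷ true ∷ [] , 3 , 5 ∷ 0 ∷ 3 ∷ 1 ∷ 2 ∷ [])
  ∷ (true ∷ false ∷ true ∷ true ∷ true ∷ true ∷ true ∷ false ∷ false ∷ true ∷ true ∷ [] , 5 , 0 ∷ 3 ∷ 4 ∷ 1 ∷ 2 ∷ [])
  ∷ (false ∷ false ∷ true ∷ true ∷ true ∷ true ∷ true ∷ true ∷ true ∷ false ∷ false ∷ [] , 7 , 1 ∷ 3 ∷ 4 ∷ 0 ∷ 2 ∷ [])
  ∷ (false ∷ false ∷ true ∷ true ∷ true ∷ true ∷ true ∷ true ∷ true ∷ true ∷ true ∷ [] , 6 , 5 ∷ 0 ∷ 3 ∷ 1 ∷ 2 ∷ [])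
  ∷ (true ∷ true ∷ false ∷ false ∷ true ∷ true ∷ false ∷ true ∷ true ∷ true ∷ true ∷ [] , 5 , 1 ∷ 3 ∷ 4 ∷ 0 ∷ 2 ∷ [])
  ∷ (false ∷ true ∷ false ∷ false ∷ true ∷ true ∷ true ∷ false ∷ false ∷ true ∷ true ∷ [] , 3 , 5 ∷ 0 ∷ 2 ∷ 1 ∷ 3 ∷ [])
  ∷ (false ∷ true ∷ false ∷ false ∷ true ∷ true ∷ true ∷ true ∷ true ∷ false ∷ false ∷ [] , 5 , 1 ∷ 3 ∷ 4 ∷ 2 ∷ 0 ∷ [])
  ∷ (false ∷ true ∷ false ∷ false ∷ true ∷ true ∷ true ∷ true ∷ true ∷ true ∷ true ∷ [] , 5 , 1 ∷ 3 ∷ 4 ∷ 2 ∷ 0 ∷ [])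
  ∷ (false ∷ true ∷ true ∷ true ∷ false ∷ false ∷ false ∷ true ∷ true ∷ true ∷ true ∷ [] , 7 , 0 ∷ 3 ∷ 4 ∷ 1 ∷ 2 ∷ [])
  ∷ (false ∷ true ∷ true ∷ true ∷ false ∷ false ∷ true ∷ false ∷ false ∷ true ∷ true ∷ [] , 5 , 0 ∷ 3 ∷ 4 ∷ 2 ∷ 1 ∷ [])
  ∷ (false ∷ true ∷ true ∷ true ∷ false ∷ false ∷ true ∷ true ∷ true ∷ false ∷ false ∷ [] , 9 , 2 ∷ 3 ∷ 5 ∷ 6 ∷ 0 ∷ 1 ∷ [])
  ∷ (true ∷ true ∷ true ∷ true ∷ false ∷ false ∷ true ∷ true ∷ true ∷ true ∷ true ∷ [] , 11 , 0 ∷ 1 ∷ 5 ∷ 3 ∷ 4 ∷ 2 ∷ [])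
  ∷ (false ∷ true ∷ true ∷ true ∷ true ∷ true ∷ false ∷ true ∷ true ∷ true ∷ true ∷ [] , 6 , 5 ∷ 1 ∷ 3 ∷ 0 ∷ 2 ∷ [])
  ∷ (false ∷ true ∷ true ∷ true ∷ true ∷ true ∷ true ∷ false ∷ false ∷ true ∷ true ∷ [] , 5 , 0 ∷ 3 ∷ 4 ∷ 2 ∷ 1 ∷ [])
  ∷ (true ∷ true ∷ true ∷ true ∷ true ∷ true ∷ true ∷ true ∷ true ∷ false ∷ false ∷ [] , 11 , 1 ∷ 0 ∷ 5 ∷ 3 ∷ 4 ∷ 2 ∷ [])
  ∷ (false ∷ true ∷ true ∷ true ∷ true ∷ true ∷ true ∷ true ∷ true ∷ true ∷ true ∷ [] , 11 , 0 ∷ 5 ∷ 1 ∷ 3 ∷ 4 ∷ 2 ∷ [])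
  ∷ [])

stage₃ : Stage
stage₃ = stage 4 (fromEdges 5 ((0 , 4) ∷ (1 , 2) ∷ (1 , 3) ∷ (1 , 4) ∷ (2 , 3) ∷ (2 , 4) ∷ (3 , 4) ∷ [])) cycleBlowup
  (# 0 ∷ # 2 ∷ # 2 ∷ # 2 ∷ # 1 ∷ [])
  ( (false ∷ true ∷ true ∷ true ∷ true ∷ [] , # 2)
  ∷ (true ∷ false ∷ false ∷ false ∷ true ∷ [] , # 0)
  ∷ (true ∷ true ∷ true ∷ true ∷ false ∷ [] , # 3)
  ∷ [])
  ( (false ∷ false ∷ false ∷ false ∷ true ∷ [] , 15 , 0 ∷ 1 ∷ 2 ∷ 3 ∷ 5 ∷ [])
  ∷ (false ∷ false ∷ false ∷ true ∷ false ∷ [] , 2 , 4 ∷ 5 ∷ 2 ∷ 0 ∷ 1 ∷ [])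
  ∷ (false ∷ false ∷ false ∷ true ∷ true ∷ [] , 3 , 5 ∷ 0 ∷ 4 ∷ 2 ∷ 1 ∷ [])
  ∷ (false ∷ false ∷ true ∷ false ∷ false ∷ [] , 2 , 3 ∷ 5 ∷ 2 ∷ 0 ∷ 1 ∷ [])
  ∷ (false ∷ false ∷ true ∷ false ∷ true ∷ [] , 3 , 5 ∷ 0 ∷ 3 ∷ 2 ∷ 1 ∷ [])
  ∷ (false ∷ false ∷ true ∷ true ∷ false ∷ [] , 2 , 3 ∷ 5 ∷ 2 ∷ 0 ∷ 1 ∷ [])
  ∷ (false ∷ false ∷ true ∷ true ∷ true ∷ [] , 3 , 5 ∷ 0 ∷ 3 ∷ 2 ∷ 1 ∷ [])
  ∷ (false ∷ true ∷ false ∷ false ∷ false ∷ [] , 2 , 2 ∷ 5 ∷ 3 ∷ 0 ∷ 1 ∷ [])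
  ∷ (false ∷ true ∷ false ∷ false ∷ true ∷ [] , 3 , 5 ∷ 0 ∷ 2 ∷ 3 ∷ 1 ∷ [])
  ∷ (false ∷ true ∷ false ∷ true ∷ false ∷ [] , 2 , 2 ∷ 5 ∷ 3 ∷ 0 ∷ 1 ∷ [])
  ∷ (false ∷ true ∷ false ∷ true ∷ true ∷ [] , 3 , 5 ∷ 0 ∷ 2 ∷ 3 ∷ 1 ∷ [])
  ∷ (false ∷ true ∷ true ∷ false ∷ false ∷ [] , 2 , 2 ∷ 5 ∷ 4 ∷ 0 ∷ 1 ∷ [])
  ∷ (false ∷ true ∷ true ∷ false ∷ true ∷ [] , 3 , 5 ∷ 0 ∷ 2 ∷ 4 ∷ 1 ∷ [])
  ∷ (false ∷ true ∷ true ∷ true ∷ false ∷ [] , 7 , 5 ∷ 2 ∷ 3 ∷ 0 ∷ 1 ∷ [])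
  ∷ (true ∷ false ∷ false ∷ false ∷ false ∷ [] , 5 , 5 ∷ 2 ∷ 3 ∷ 1 ∷ 0 ∷ [])
  ∷ (true ∷ false ∷ false ∷ true ∷ false ∷ [] , 5 , 4 ∷ 2 ∷ 3 ∷ 0 ∷ 1 ∷ [])
  ∷ (true ∷ false ∷ false ∷ true ∷ true ∷ [] , 5 , 4 ∷ 2 ∷ 3 ∷ 0 ∷ 1 ∷ [])
  ∷ (true ∷ false ∷ true ∷ false ∷ false ∷ [] , 5 , 3 ∷ 2 ∷ 4 ∷ 0 ∷ 1 ∷ [])
  ∷ (true ∷ false ∷ true ∷ false ∷ true ∷ [] , 5 , 3 ∷ 2 ∷ 4 ∷ 0 ∷ 1 ∷ [])
  ∷ (true ∷ false ∷ true ∷ true ∷ false ∷ [] , 7 , 0 ∷ 3 ∷ 4 ∷ 2 ∷ 1 ∷ [])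
  ∷ (true ∷ false ∷ true ∷ true ∷ true ∷ [] , 6 , 5 ∷ 1 ∷ 0 ∷ 3 ∷ 2 ∷ [])
  ∷ (true ∷ true ∷ false ∷ false ∷ false ∷ [] , 5 , 2 ∷ 3 ∷ 4 ∷ 0 ∷ 1 ∷ [])
  ∷ (true ∷ true ∷ false ∷ false ∷ true ∷ [] , 5 , 2 ∷ 3 ∷ 4 ∷ 0 ∷ 1 ∷ [])
  ∷ (true ∷ true ∷ false ∷ true ∷ false ∷ [] , 7 , 0 ∷ 2 ∷ 4 ∷ 3 ∷ 1 ∷ [])
  ∷ (true ∷ true ∷ false ∷ true ∷ true ∷ [] , 6 , 5 ∷ 1 ∷ 0 ∷ 2 ∷ 3 ∷ [])
  ∷ (true ∷ true ∷ true ∷ false ∷ false ∷ [] , 7 , 0 ∷ 2 ∷ 3 ∷ 4 ∷ 1 ∷ [])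
  ∷ (true ∷ true ∷ true ∷ false ∷ true ∷ [] , 6 , 5 ∷ 1 ∷ 0 ∷ 2 ∷ 4 ∷ [])
  ∷ (true ∷ true ∷ true ∷ true ∷ true ∷ [] , 16 , 1 ∷ 2 ∷ 3 ∷ 0 ∷ 5 ∷ [])
  ∷ [])
  ( (true ∷ false ∷ true ∷ true ∷ true ∷ true ∷ false ∷ false ∷ false ∷ false ∷ false ∷ [] , 2 , 0 ∷ 6 ∷ 3 ∷ 1 ∷ 2 ∷ [])
  ∷ (true ∷ true ∷ false ∷ false ∷ false ∷ true ∷ false ∷ false ∷ false ∷ false ∷ false ∷ [] , 2 , 0 ∷ 6 ∷ 2 ∷ 1 ∷ 3 ∷ [])
  ∷ (true ∷ true ∷ true ∷ true ∷ true ∷ false ∷ false ∷ false ∷ false ∷ false ∷ false ∷ [] , 1 , 0 ∷ 2 ∷ 6 ∷ 3 ∷ 1 ∷ [])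
  ∷ (false ∷ false ∷ true ∷ true ∷ true ∷ true ∷ false ∷ true ∷ true ∷ true ∷ true ∷ [] , 3 , 6 ∷ 0 ∷ 3 ∷ 1 ∷ 2 ∷ [])
  ∷ (true ∷ false ∷ true ∷ true ∷ true ∷ true ∷ true ∷ false ∷ false ∷ false ∷ true ∷ [] , 5 , 0 ∷ 3 ∷ 4 ∷ 1 ∷ 2 ∷ [])
  ∷ (false ∷ false ∷ true ∷ true ∷ true ∷ true ∷ true ∷ true ∷ true ∷ true ∷ false ∷ [] , 7 , 1 ∷ 3 ∷ 4 ∷ 0 ∷ 2 ∷ [])
  ∷ (true ∷ true ∷ false ∷ false ∷ false ∷ true ∷ false ∷ true ∷ true ∷ true ∷ true ∷ [] , 5 , 1 ∷ 3 ∷ 4 ∷ 0 ∷ 2 ∷ [])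
  ∷ (false ∷ true ∷ false ∷ false ∷ false ∷ true ∷ true ∷ false ∷ false ∷ false ∷ true ∷ [] , 3 , 6 ∷ 0 ∷ 2 ∷ 1 ∷ 3 ∷ [])
  ∷ (false ∷ true ∷ false ∷ false ∷ false ∷ true ∷ true ∷ true ∷ true ∷ true ∷ false ∷ [] , 5 , 1 ∷ 3 ∷ 4 ∷ 2 ∷ 0 ∷ [])
  ∷ (false ∷ true ∷ true ∷ true ∷ true ∷ false ∷ false ∷ true ∷ true ∷ true ∷ true ∷ [] , 7 , 0 ∷ 3 ∷ 4 ∷ 1 ∷ 2 ∷ [])
  ∷ (false ∷ true ∷ true ∷ true ∷ true ∷ false ∷ true ∷ false ∷ false ∷ false ∷ true ∷ [] , 5 , 0 ∷ 3 ∷ 4 ∷ 2 ∷ 1 ∷ [])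
  ∷ (true ∷ true ∷ true ∷ true ∷ true ∷ false ∷ true ∷ true ∷ true ∷ true ∷ false ∷ [] , 16 , 2 ∷ 3 ∷ 4 ∷ 0 ∷ 1 ∷ [])
  ∷ (false ∷ true ∷ true ∷ true ∷ true ∷ false ∷ true ∷ true ∷ true ∷ true ∷ false ∷ [] , 10 , 0 ∷ 1 ∷ 6 ∷ 3 ∷ 4 ∷ 2 ∷ [])
  ∷ [])

stage₄ : Stage
stage₄ = stage 4 (fromEdges 5 ((0 , 3) ∷ (0 , 4) ∷ (1 , 2) ∷ (1 , 3) ∷ (1 , 4) ∷ (2 , 3) ∷ (2 , 4) ∷ [])) cycleBlowup
  (# 0 ∷ # 2 ∷ # 2 ∷ # 1 ∷ # 3 ∷ [])
  ( (true ∷ false ∷ false ∷ true ∷ true ∷ [] , # 0)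
  ∷ [])
  ( (false ∷ false ∷ false ∷ false ∷ true ∷ [] , 1 , 5 ∷ 1 ∷ 4 ∷ 2 ∷ 0 ∷ [])
  ∷ (false ∷ false ∷ false ∷ true ∷ false ∷ [] , 1 , 4 ∷ 1 ∷ 5 ∷ 2 ∷ 0 ∷ [])
  ∷ (false ∷ false ∷ false ∷ true ∷ true ∷ [] , 9 , 4 ∷ 5 ∷ 2 ∷ 3 ∷ 0 ∷ 1 ∷ [])
  ∷ (false ∷ false ∷ true ∷ false ∷ false ∷ [] , 1 , 3 ∷ 4 ∷ 1 ∷ 5 ∷ 0 ∷ [])
  ∷ (false ∷ false ∷ true ∷ false ∷ true ∷ [] , 1 , 5 ∷ 1 ∷ 4 ∷ 2 ∷ 0 ∷ [])
  ∷ (false ∷ false ∷ true ∷ true ∷ false ∷ [] , 1 , 4 ∷ 1 ∷ 5 ∷ 2 ∷ 0 ∷ [])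
  ∷ (false ∷ false ∷ true ∷ true ∷ true ∷ [] , 3 , 4 ∷ 0 ∷ 3 ∷ 2 ∷ 1 ∷ [])
  ∷ (false ∷ true ∷ false ∷ false ∷ false ∷ [] , 1 , 2 ∷ 4 ∷ 1 ∷ 5 ∷ 0 ∷ [])
  ∷ (false ∷ true ∷ false ∷ false ∷ true ∷ [] , 1 , 5 ∷ 1 ∷ 4 ∷ 3 ∷ 0 ∷ [])
  ∷ (false ∷ true ∷ false ∷ true ∷ false ∷ [] , 1 , 4 ∷ 1 ∷ 5 ∷ 3 ∷ 0 ∷ [])
  ∷ (false ∷ true ∷ false ∷ true ∷ true ∷ [] , 3 , 4 ∷ 0 ∷ 2 ∷ 3 ∷ 1 ∷ [])
  ∷ (false ∷ true ∷ true ∷ false ∷ false ∷ [] , 1 , 2 ∷ 4 ∷ 1 ∷ 5 ∷ 0 ∷ [])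
  ∷ (false ∷ true ∷ true ∷ false ∷ true ∷ [] , 7 , 4 ∷ 2 ∷ 3 ∷ 0 ∷ 1 ∷ [])
  ∷ (false ∷ true ∷ true ∷ true ∷ false ∷ [] , 7 , 5 ∷ 2 ∷ 3 ∷ 0 ∷ 1 ∷ [])
  ∷ (false ∷ true ∷ true ∷ true ∷ true ∷ [] , 17 , 1 ∷ 0 ∷ 2 ∷ 3 ∷ 4 ∷ [])
  ∷ (true ∷ false ∷ false ∷ false ∷ false ∷ [] , 1 , 1 ∷ 4 ∷ 2 ∷ 5 ∷ 0 ∷ [])
  ∷ (true ∷ false ∷ false ∷ false ∷ true ∷ [] , 5 , 4 ∷ 2 ∷ 3 ∷ 1 ∷ 0 ∷ [])
  ∷ (true ∷ false ∷ false ∷ true ∷ false ∷ [] , 5 , 5 ∷ 2 ∷ 3 ∷ 1 ∷ 0 ∷ [])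
  ∷ (true ∷ false ∷ true ∷ false ∷ false ∷ [] , 1 , 1 ∷ 4 ∷ 2 ∷ 5 ∷ 0 ∷ [])
  ∷ (true ∷ false ∷ true ∷ false ∷ true ∷ [] , 6 , 3 ∷ 0 ∷ 5 ∷ 2 ∷ 4 ∷ [])
  ∷ (true ∷ false ∷ true ∷ true ∷ false ∷ [] , 6 , 3 ∷ 0 ∷ 4 ∷ 2 ∷ 5 ∷ [])
  ∷ (true ∷ false ∷ true ∷ true ∷ true ∷ [] , 6 , 4 ∷ 1 ∷ 0 ∷ 3 ∷ 2 ∷ [])
  ∷ (true ∷ true ∷ false ∷ false ∷ false ∷ [] , 1 , 1 ∷ 4 ∷ 3 ∷ 5 ∷ 0 ∷ [])
  ∷ (true ∷ true ∷ false ∷ false ∷ true ∷ [] , 6 , 2 ∷ 0 ∷ 5 ∷ 3 ∷ 4 ∷ [])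
  ∷ (true ∷ true ∷ false ∷ true ∷ false ∷ [] , 6 , 2 ∷ 0 ∷ 4 ∷ 3 ∷ 5 ∷ [])
  ∷ (true ∷ true ∷ false ∷ true ∷ true ∷ [] , 6 , 4 ∷ 1 ∷ 0 ∷ 2 ∷ 3 ∷ [])
  ∷ (true ∷ true ∷ true ∷ false ∷ false ∷ [] , 10 , 0 ∷ 4 ∷ 5 ∷ 2 ∷ 3 ∷ 1 ∷ [])
  ∷ (true ∷ true ∷ true ∷ false ∷ true ∷ [] , 16 , 1 ∷ 2 ∷ 3 ∷ 0 ∷ 5 ∷ [])
  ∷ (true ∷ true ∷ true ∷ true ∷ false ∷ [] , 16 , 1 ∷ 2 ∷ 3 ∷ 0 ∷ 4 ∷ [])
  ∷ (true ∷ true ∷ true ∷ true ∷ true ∷ [] , 11 , 4 ∷ 0 ∷ 5 ∷ 2 ∷ 3 ∷ 1 ∷ [])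
  ∷ [])
  ( (true ∷ true ∷ false ∷ false ∷ true ∷ true ∷ false ∷ false ∷ false ∷ false ∷ false ∷ [] , 1 , 0 ∷ 5 ∷ 3 ∷ 6 ∷ 1 ∷ [])
  ∷ (true ∷ true ∷ false ∷ false ∷ true ∷ true ∷ true ∷ false ∷ false ∷ true ∷ true ∷ [] , 17 , 3 ∷ 0 ∷ 1 ∷ 2 ∷ 5 ∷ [])
  ∷ (false ∷ true ∷ false ∷ false ∷ true ∷ true ∷ true ∷ false ∷ false ∷ true ∷ true ∷ [] , 3 , 5 ∷ 0 ∷ 2 ∷ 1 ∷ 3 ∷ [])
  ∷ [])

stage₅ : Stage
stage₅ = stage 4 (fromEdges 5 ((0 , 3) ∷ (0 , 4) ∷ (1 , 2) ∷ (1 , 4) ∷ (2 , 3) ∷ [])) pentagon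
  (# 0 ∷ # 2 ∷ # 3 ∷ # 4 ∷ # 1 ∷ [])
  []
  ( (false ∷ false ∷ false ∷ false ∷ true ∷ [] , 0 , 5 ∷ 0 ∷ 1 ∷ 2 ∷ 3 ∷ [])
  ∷ (false ∷ false ∷ false ∷ true ∷ false ∷ [] , 0 , 4 ∷ 0 ∷ 1 ∷ 3 ∷ 2 ∷ [])
  ∷ (false ∷ false ∷ false ∷ true ∷ true ∷ [] , 0 , 4 ∷ 0 ∷ 1 ∷ 3 ∷ 2 ∷ [])
  ∷ (false ∷ false ∷ true ∷ false ∷ false ∷ [] , 0 , 3 ∷ 0 ∷ 2 ∷ 4 ∷ 1 ∷ [])
  ∷ (false ∷ false ∷ true ∷ false ∷ true ∷ [] , 0 , 3 ∷ 0 ∷ 2 ∷ 4 ∷ 1 ∷ [])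
  ∷ (false ∷ false ∷ true ∷ true ∷ false ∷ [] , 2 , 3 ∷ 4 ∷ 0 ∷ 2 ∷ 1 ∷ [])
  ∷ (false ∷ false ∷ true ∷ true ∷ true ∷ [] , 1 , 5 ∷ 0 ∷ 3 ∷ 2 ∷ 1 ∷ [])
  ∷ (false ∷ true ∷ false ∷ false ∷ false ∷ [] , 0 , 2 ∷ 0 ∷ 3 ∷ 5 ∷ 1 ∷ [])
  ∷ (false ∷ true ∷ false ∷ false ∷ true ∷ [] , 2 , 2 ∷ 5 ∷ 0 ∷ 3 ∷ 1 ∷ [])
  ∷ (false ∷ true ∷ false ∷ true ∷ false ∷ [] , 0 , 2 ∷ 0 ∷ 3 ∷ 5 ∷ 1 ∷ [])
  ∷ (false ∷ true ∷ false ∷ true ∷ true ∷ [] , 1 , 4 ∷ 0 ∷ 2 ∷ 3 ∷ 1 ∷ [])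
  ∷ (false ∷ true ∷ true ∷ false ∷ false ∷ [] , 2 , 2 ∷ 3 ∷ 0 ∷ 5 ∷ 4 ∷ [])
  ∷ (false ∷ true ∷ true ∷ false ∷ true ∷ [] , 5 , 3 ∷ 0 ∷ 2 ∷ 4 ∷ 1 ∷ [])
  ∷ (false ∷ true ∷ true ∷ true ∷ false ∷ [] , 5 , 2 ∷ 0 ∷ 3 ∷ 5 ∷ 1 ∷ [])
  ∷ (false ∷ true ∷ true ∷ true ∷ true ∷ [] , 6 , 0 ∷ 4 ∷ 3 ∷ 2 ∷ 5 ∷ [])
  ∷ (true ∷ false ∷ false ∷ false ∷ false ∷ [] , 0 , 1 ∷ 0 ∷ 4 ∷ 5 ∷ 2 ∷ [])
  ∷ (true ∷ false ∷ false ∷ false ∷ true ∷ [] , 2 , 1 ∷ 5 ∷ 0 ∷ 4 ∷ 2 ∷ [])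
  ∷ (true ∷ false ∷ false ∷ true ∷ false ∷ [] , 2 , 1 ∷ 4 ∷ 0 ∷ 5 ∷ 3 ∷ [])
  ∷ (true ∷ false ∷ false ∷ true ∷ true ∷ [] , 5 , 4 ∷ 0 ∷ 1 ∷ 3 ∷ 2 ∷ [])
  ∷ (true ∷ false ∷ true ∷ false ∷ false ∷ [] , 0 , 1 ∷ 0 ∷ 4 ∷ 5 ∷ 2 ∷ [])
  ∷ (true ∷ false ∷ true ∷ false ∷ true ∷ [] , 1 , 3 ∷ 0 ∷ 1 ∷ 4 ∷ 2 ∷ [])
  ∷ (true ∷ false ∷ true ∷ true ∷ false ∷ [] , 5 , 1 ∷ 0 ∷ 4 ∷ 5 ∷ 2 ∷ [])
  ∷ (true ∷ false ∷ true ∷ true ∷ true ∷ [] , 6 , 0 ∷ 3 ∷ 4 ∷ 1 ∷ 5 ∷ [])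
  ∷ (true ∷ true ∷ false ∷ false ∷ false ∷ [] , 0 , 1 ∷ 0 ∷ 5 ∷ 4 ∷ 3 ∷ [])
  ∷ (true ∷ true ∷ false ∷ false ∷ true ∷ [] , 5 , 1 ∷ 0 ∷ 5 ∷ 4 ∷ 3 ∷ [])
  ∷ (true ∷ true ∷ false ∷ true ∷ false ∷ [] , 1 , 2 ∷ 0 ∷ 1 ∷ 5 ∷ 3 ∷ [])
  ∷ (true ∷ true ∷ false ∷ true ∷ true ∷ [] , 6 , 0 ∷ 2 ∷ 5 ∷ 1 ∷ 4 ∷ [])
  ∷ (true ∷ true ∷ true ∷ false ∷ false ∷ [] , 1 , 1 ∷ 0 ∷ 2 ∷ 5 ∷ 4 ∷ [])
  ∷ (true ∷ true ∷ true ∷ false ∷ true ∷ [] , 6 , 0 ∷ 1 ∷ 5 ∷ 2 ∷ 3 ∷ [])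
  ∷ (true ∷ true ∷ true ∷ true ∷ false ∷ [] , 6 , 0 ∷ 1 ∷ 4 ∷ 3 ∷ 2 ∷ [])
  ∷ (true ∷ true ∷ true ∷ true ∷ true ∷ [] , 6 , 0 ∷ 1 ∷ 4 ∷ 3 ∷ 2 ∷ [])
  ∷ [])
  []

stage₆ : Stage
stage₆ = stage 4 (fromEdges 5 ((0 , 2) ∷ (0 , 3) ∷ (0 , 4) ∷ (1 , 2) ∷ (1 , 3) ∷ (1 , 4) ∷ (2 , 4) ∷ (3 , 4) ∷ [])) multipartite
  (# 0 ∷ # 0 ∷ # 1 ∷ # 1 ∷ # 2 ∷ [])
  ( (false ∷ false ∷ true ∷ true ∷ true ∷ [] , # 0)
  ∷ (true ∷ true ∷ false ∷ false ∷ true ∷ [] , # 1)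
  ∷ (true ∷ true ∷ true ∷ true ∷ false ∷ [] , # 2)
  ∷ (true ∷ true ∷ true ∷ true ∷ true ∷ [] , # 3)
  ∷ [])
  ( (false ∷ false ∷ false ∷ false ∷ true ∷ [] , 3 , 5 ∷ 1 ∷ 3 ∷ 2 ∷ 0 ∷ [])
  ∷ (false ∷ false ∷ false ∷ true ∷ false ∷ [] , 1 , 4 ∷ 1 ∷ 3 ∷ 2 ∷ 0 ∷ [])
  ∷ (false ∷ false ∷ false ∷ true ∷ true ∷ [] , 1 , 4 ∷ 1 ∷ 3 ∷ 2 ∷ 0 ∷ [])
  ∷ (false ∷ false ∷ true ∷ false ∷ false ∷ [] , 1 , 3 ∷ 1 ∷ 4 ∷ 2 ∷ 0 ∷ [])
  ∷ (false ∷ false ∷ true ∷ false ∷ true ∷ [] , 1 , 3 ∷ 1 ∷ 4 ∷ 2 ∷ 0 ∷ [])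
  ∷ (false ∷ false ∷ true ∷ true ∷ false ∷ [] , 3 , 3 ∷ 1 ∷ 5 ∷ 2 ∷ 0 ∷ [])
  ∷ (false ∷ true ∷ false ∷ false ∷ false ∷ [] , 1 , 2 ∷ 3 ∷ 1 ∷ 4 ∷ 0 ∷ [])
  ∷ (false ∷ true ∷ false ∷ false ∷ true ∷ [] , 1 , 2 ∷ 3 ∷ 1 ∷ 4 ∷ 0 ∷ [])
  ∷ (false ∷ true ∷ false ∷ true ∷ false ∷ [] , 6 , 2 ∷ 0 ∷ 4 ∷ 5 ∷ 3 ∷ [])
  ∷ (false ∷ true ∷ false ∷ true ∷ true ∷ [] , 6 , 5 ∷ 0 ∷ 2 ∷ 3 ∷ 1 ∷ [])
  ∷ (false ∷ true ∷ true ∷ false ∷ false ∷ [] , 6 , 2 ∷ 0 ∷ 3 ∷ 5 ∷ 4 ∷ [])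
  ∷ (false ∷ true ∷ true ∷ false ∷ true ∷ [] , 6 , 5 ∷ 0 ∷ 2 ∷ 4 ∷ 1 ∷ [])
  ∷ (false ∷ true ∷ true ∷ true ∷ false ∷ [] , 6 , 3 ∷ 0 ∷ 2 ∷ 5 ∷ 1 ∷ [])
  ∷ (false ∷ true ∷ true ∷ true ∷ true ∷ [] , 11 , 3 ∷ 5 ∷ 4 ∷ 0 ∷ 2 ∷ 1 ∷ [])
  ∷ (true ∷ false ∷ false ∷ false ∷ false ∷ [] , 1 , 1 ∷ 3 ∷ 2 ∷ 4 ∷ 0 ∷ [])
  ∷ (true ∷ false ∷ false ∷ false ∷ true ∷ [] , 1 , 1 ∷ 3 ∷ 2 ∷ 4 ∷ 0 ∷ [])
  ∷ (true ∷ false ∷ false ∷ true ∷ false ∷ [] , 6 , 1 ∷ 0 ∷ 4 ∷ 5 ∷ 3 ∷ [])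
  ∷ (true ∷ false ∷ false ∷ true ∷ true ∷ [] , 6 , 5 ∷ 0 ∷ 1 ∷ 3 ∷ 2 ∷ [])
  ∷ (true ∷ false ∷ true ∷ false ∷ false ∷ [] , 6 , 1 ∷ 0 ∷ 3 ∷ 5 ∷ 4 ∷ [])
  ∷ (true ∷ false ∷ true ∷ false ∷ true ∷ [] , 6 , 5 ∷ 0 ∷ 1 ∷ 4 ∷ 2 ∷ [])
  ∷ (true ∷ false ∷ true ∷ true ∷ false ∷ [] , 6 , 3 ∷ 0 ∷ 1 ∷ 5 ∷ 2 ∷ [])
  ∷ (true ∷ false ∷ true ∷ true ∷ true ∷ [] , 11 , 3 ∷ 5 ∷ 4 ∷ 0 ∷ 1 ∷ 2 ∷ [])
  ∷ (true ∷ true ∷ false ∷ false ∷ false ∷ [] , 3 , 1 ∷ 3 ∷ 5 ∷ 4 ∷ 0 ∷ [])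
  ∷ (true ∷ true ∷ false ∷ true ∷ false ∷ [] , 6 , 1 ∷ 0 ∷ 4 ∷ 5 ∷ 3 ∷ [])
  ∷ (true ∷ true ∷ false ∷ true ∷ true ∷ [] , 11 , 1 ∷ 5 ∷ 2 ∷ 0 ∷ 4 ∷ 3 ∷ [])
  ∷ (true ∷ true ∷ true ∷ false ∷ false ∷ [] , 6 , 1 ∷ 0 ∷ 3 ∷ 5 ∷ 4 ∷ [])
  ∷ (true ∷ true ∷ true ∷ false ∷ true ∷ [] , 11 , 1 ∷ 5 ∷ 2 ∷ 0 ∷ 3 ∷ 4 ∷ [])
  ∷ [])
  ( (true ∷ false ∷ false ∷ true ∷ true ∷ true ∷ false ∷ false ∷ false ∷ false ∷ false ∷ [] , 0 , 4 ∷ 2 ∷ 3 ∷ 0 ∷ 1 ∷ [])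
  ∷ (true ∷ true ∷ true ∷ false ∷ false ∷ true ∷ false ∷ false ∷ false ∷ false ∷ false ∷ [] , 0 , 2 ∷ 4 ∷ 5 ∷ 0 ∷ 1 ∷ [])
  ∷ (true ∷ true ∷ true ∷ true ∷ true ∷ false ∷ false ∷ false ∷ false ∷ false ∷ false ∷ [] , 1 , 0 ∷ 2 ∷ 6 ∷ 3 ∷ 1 ∷ [])
  ∷ (true ∷ true ∷ true ∷ true ∷ true ∷ true ∷ false ∷ false ∷ false ∷ false ∷ false ∷ [] , 3 , 0 ∷ 2 ∷ 4 ∷ 3 ∷ 1 ∷ [])
  ∷ (true ∷ false ∷ false ∷ true ∷ true ∷ true ∷ false ∷ false ∷ true ∷ true ∷ true ∷ [] , 9 , 4 ∷ 5 ∷ 0 ∷ 1 ∷ 2 ∷ 3 ∷ [])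
  ∷ (false ∷ false ∷ false ∷ true ∷ true ∷ true ∷ true ∷ true ∷ false ∷ false ∷ true ∷ [] , 1 , 2 ∷ 4 ∷ 0 ∷ 5 ∷ 1 ∷ [])
  ∷ (false ∷ false ∷ false ∷ true ∷ true ∷ true ∷ true ∷ true ∷ true ∷ true ∷ false ∷ [] , 1 , 6 ∷ 2 ∷ 1 ∷ 3 ∷ 0 ∷ [])
  ∷ (false ∷ false ∷ false ∷ true ∷ true ∷ true ∷ true ∷ true ∷ true ∷ true ∷ true ∷ [] , 3 , 4 ∷ 2 ∷ 1 ∷ 3 ∷ 0 ∷ [])
  ∷ (false ∷ true ∷ true ∷ false ∷ false ∷ true ∷ false ∷ false ∷ true ∷ true ∷ true ∷ [] , 1 , 2 ∷ 4 ∷ 1 ∷ 5 ∷ 0 ∷ [])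
  ∷ (true ∷ true ∷ true ∷ false ∷ false ∷ true ∷ true ∷ true ∷ false ∷ false ∷ true ∷ [] , 9 , 2 ∷ 3 ∷ 0 ∷ 1 ∷ 4 ∷ 5 ∷ [])
  ∷ (false ∷ true ∷ true ∷ false ∷ false ∷ true ∷ true ∷ true ∷ true ∷ true ∷ false ∷ [] , 1 , 6 ∷ 4 ∷ 1 ∷ 5 ∷ 0 ∷ [])
  ∷ (false ∷ true ∷ true ∷ false ∷ false ∷ true ∷ true ∷ true ∷ true ∷ true ∷ true ∷ [] , 3 , 2 ∷ 4 ∷ 1 ∷ 5 ∷ 0 ∷ [])
  ∷ (false ∷ true ∷ true ∷ true ∷ true ∷ false ∷ false ∷ false ∷ true ∷ true ∷ true ∷ [] , 1 , 6 ∷ 2 ∷ 0 ∷ 3 ∷ 1 ∷ [])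
  ∷ (false ∷ true ∷ true ∷ true ∷ true ∷ false ∷ true ∷ true ∷ false ∷ false ∷ true ∷ [] , 1 , 6 ∷ 4 ∷ 0 ∷ 5 ∷ 1 ∷ [])
  ∷ (true ∷ true ∷ true ∷ true ∷ true ∷ false ∷ true ∷ true ∷ true ∷ true ∷ false ∷ [] , 11 , 2 ∷ 4 ∷ 3 ∷ 0 ∷ 1 ∷ 6 ∷ [])
  ∷ (false ∷ true ∷ true ∷ true ∷ true ∷ false ∷ true ∷ true ∷ true ∷ true ∷ true ∷ [] , 11 , 2 ∷ 4 ∷ 3 ∷ 1 ∷ 6 ∷ 0 ∷ [])
  ∷ (false ∷ true ∷ true ∷ true ∷ true ∷ true ∷ false ∷ false ∷ true ∷ true ∷ true ∷ [] , 3 , 4 ∷ 2 ∷ 0 ∷ 3 ∷ 1 ∷ [])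
  ∷ (false ∷ true ∷ true ∷ true ∷ true ∷ true ∷ true ∷ true ∷ false ∷ false ∷ true ∷ [] , 3 , 2 ∷ 4 ∷ 0 ∷ 5 ∷ 1 ∷ [])
  ∷ (false ∷ true ∷ true ∷ true ∷ true ∷ true ∷ true ∷ true ∷ true ∷ true ∷ false ∷ [] , 11 , 2 ∷ 4 ∷ 3 ∷ 0 ∷ 6 ∷ 1 ∷ [])
  ∷ (true ∷ true ∷ true ∷ true ∷ true ∷ true ∷ true ∷ true ∷ true ∷ true ∷ true ∷ [] , 12 , 0 ∷ 1 ∷ 6 ∷ 2 ∷ 4 ∷ 3 ∷ 5 ∷ [])
  ∷ [])

stage₇ : Stage
stage₇ = stage 4 (fromEdges 5 ((0 , 3) ∷ (0 , 4) ∷ (1 , 3) ∷ (1 , 4) ∷ (2 , 3) ∷ (2 , 4) ∷ [])) multipartite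
  (# 0 ∷ # 0 ∷ # 0 ∷ # 1 ∷ # 1 ∷ [])
  ( (false ∷ false ∷ false ∷ true ∷ true ∷ [] , # 0)
  ∷ (true ∷ true ∷ true ∷ false ∷ false ∷ [] , # 1)
  ∷ [])
  ( (false ∷ false ∷ false ∷ false ∷ true ∷ [] , 1 , 5 ∷ 1 ∷ 4 ∷ 2 ∷ 0 ∷ [])
  ∷ (false ∷ false ∷ false ∷ true ∷ false ∷ [] , 1 , 4 ∷ 1 ∷ 5 ∷ 2 ∷ 0 ∷ [])
  ∷ (false ∷ false ∷ true ∷ false ∷ false ∷ [] , 0 , 4 ∷ 1 ∷ 2 ∷ 3 ∷ 0 ∷ [])
  ∷ (false ∷ false ∷ true ∷ false ∷ true ∷ [] , 0 , 4 ∷ 1 ∷ 2 ∷ 3 ∷ 0 ∷ [])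
  ∷ (false ∷ false ∷ true ∷ true ∷ false ∷ [] , 0 , 5 ∷ 1 ∷ 2 ∷ 3 ∷ 0 ∷ [])
  ∷ (false ∷ false ∷ true ∷ true ∷ true ∷ [] , 9 , 4 ∷ 5 ∷ 0 ∷ 3 ∷ 1 ∷ 2 ∷ [])
  ∷ (false ∷ true ∷ false ∷ false ∷ false ∷ [] , 0 , 4 ∷ 1 ∷ 3 ∷ 2 ∷ 0 ∷ [])
  ∷ (false ∷ true ∷ false ∷ false ∷ true ∷ [] , 0 , 4 ∷ 1 ∷ 3 ∷ 2 ∷ 0 ∷ [])
  ∷ (false ∷ true ∷ false ∷ true ∷ false ∷ [] , 0 , 5 ∷ 1 ∷ 3 ∷ 2 ∷ 0 ∷ [])
  ∷ (false ∷ true ∷ false ∷ true ∷ true ∷ [] , 9 , 4 ∷ 5 ∷ 0 ∷ 2 ∷ 1 ∷ 3 ∷ [])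
  ∷ (false ∷ true ∷ true ∷ false ∷ false ∷ [] , 1 , 2 ∷ 4 ∷ 1 ∷ 5 ∷ 0 ∷ [])
  ∷ (false ∷ true ∷ true ∷ false ∷ true ∷ [] , 1 , 4 ∷ 2 ∷ 0 ∷ 3 ∷ 1 ∷ [])
  ∷ (false ∷ true ∷ true ∷ true ∷ false ∷ [] , 1 , 5 ∷ 2 ∷ 0 ∷ 3 ∷ 1 ∷ [])
  ∷ (false ∷ true ∷ true ∷ true ∷ true ∷ [] , 3 , 4 ∷ 2 ∷ 0 ∷ 3 ∷ 1 ∷ [])
  ∷ (true ∷ false ∷ false ∷ false ∷ false ∷ [] , 0 , 4 ∷ 2 ∷ 3 ∷ 1 ∷ 0 ∷ [])
  ∷ (true ∷ false ∷ false ∷ false ∷ true ∷ [] , 0 , 4 ∷ 2 ∷ 3 ∷ 1 ∷ 0 ∷ [])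
  ∷ (true ∷ false ∷ false ∷ true ∷ false ∷ [] , 0 , 5 ∷ 2 ∷ 3 ∷ 1 ∷ 0 ∷ [])
  ∷ (true ∷ false ∷ false ∷ true ∷ true ∷ [] , 9 , 4 ∷ 5 ∷ 0 ∷ 1 ∷ 2 ∷ 3 ∷ [])
  ∷ (true ∷ false ∷ true ∷ false ∷ false ∷ [] , 1 , 1 ∷ 4 ∷ 2 ∷ 5 ∷ 0 ∷ [])
  ∷ (true ∷ false ∷ true ∷ false ∷ true ∷ [] , 1 , 4 ∷ 1 ∷ 0 ∷ 3 ∷ 2 ∷ [])
  ∷ (true ∷ false ∷ true ∷ true ∷ false ∷ [] , 1 , 5 ∷ 1 ∷ 0 ∷ 3 ∷ 2 ∷ [])
  ∷ (true ∷ false ∷ true ∷ true ∷ true ∷ [] , 3 , 4 ∷ 1 ∷ 0 ∷ 3 ∷ 2 ∷ [])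
  ∷ (true ∷ true ∷ false ∷ false ∷ false ∷ [] , 1 , 1 ∷ 4 ∷ 3 ∷ 5 ∷ 0 ∷ [])
  ∷ (true ∷ true ∷ false ∷ false ∷ true ∷ [] , 1 , 4 ∷ 1 ∷ 0 ∷ 2 ∷ 3 ∷ [])
  ∷ (true ∷ true ∷ false ∷ true ∷ false ∷ [] , 1 , 5 ∷ 1 ∷ 0 ∷ 2 ∷ 3 ∷ [])
  ∷ (true ∷ true ∷ false ∷ true ∷ true ∷ [] , 3 , 4 ∷ 1 ∷ 0 ∷ 2 ∷ 3 ∷ [])
  ∷ (true ∷ true ∷ true ∷ false ∷ true ∷ [] , 10 , 1 ∷ 2 ∷ 3 ∷ 0 ∷ 5 ∷ 4 ∷ [])
  ∷ (true ∷ true ∷ true ∷ true ∷ false ∷ [] , 10 , 1 ∷ 2 ∷ 3 ∷ 0 ∷ 4 ∷ 5 ∷ [])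
  ∷ (true ∷ true ∷ true ∷ true ∷ true ∷ [] , 20 , 1 ∷ 2 ∷ 4 ∷ 5 ∷ 0 ∷ [])
  ∷ [])
  ( (true ∷ false ∷ false ∷ false ∷ true ∷ true ∷ false ∷ false ∷ false ∷ false ∷ false ∷ [] , 0 , 5 ∷ 2 ∷ 3 ∷ 0 ∷ 1 ∷ [])
  ∷ (true ∷ true ∷ true ∷ true ∷ false ∷ false ∷ false ∷ false ∷ false ∷ false ∷ false ∷ [] , 0 , 2 ∷ 5 ∷ 6 ∷ 0 ∷ 1 ∷ [])
  ∷ (true ∷ false ∷ false ∷ false ∷ true ∷ true ∷ false ∷ false ∷ false ∷ true ∷ true ∷ [] , 8 , 5 ∷ 0 ∷ 1 ∷ 2 ∷ 3 ∷ 4 ∷ [])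
  ∷ (false ∷ false ∷ false ∷ false ∷ true ∷ true ∷ true ∷ true ∷ true ∷ false ∷ false ∷ [] , 1 , 2 ∷ 5 ∷ 0 ∷ 6 ∷ 1 ∷ [])
  ∷ (false ∷ true ∷ true ∷ true ∷ false ∷ false ∷ false ∷ false ∷ false ∷ true ∷ true ∷ [] , 1 , 2 ∷ 5 ∷ 1 ∷ 6 ∷ 0 ∷ [])
  ∷ (true ∷ true ∷ true ∷ true ∷ false ∷ false ∷ true ∷ true ∷ true ∷ false ∷ false ∷ [] , 9 , 2 ∷ 3 ∷ 0 ∷ 1 ∷ 5 ∷ 6 ∷ [])
  ∷ [])

stage₈ : Stage
stage₈ = stage 4 (fromEdges 5 ((0 , 3) ∷ (0 , 4) ∷ (1 , 2) ∷ (1 , 4) ∷ (2 , 4) ∷ (3 , 4) ∷ [])) cycleBlowup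
  (# 0 ∷ # 2 ∷ # 2 ∷ # 0 ∷ # 1 ∷ [])
  []
  ( (false ∷ false ∷ false ∷ false ∷ true ∷ [] , 15 , 0 ∷ 1 ∷ 2 ∷ 3 ∷ 5 ∷ [])
  ∷ (false ∷ false ∷ false ∷ true ∷ false ∷ [] , 2 , 4 ∷ 5 ∷ 1 ∷ 0 ∷ 2 ∷ [])
  ∷ (false ∷ false ∷ false ∷ true ∷ true ∷ [] , 3 , 5 ∷ 0 ∷ 4 ∷ 1 ∷ 2 ∷ [])
  ∷ (false ∷ false ∷ true ∷ false ∷ false ∷ [] , 2 , 3 ∷ 5 ∷ 2 ∷ 0 ∷ 1 ∷ [])
  ∷ (false ∷ false ∷ true ∷ false ∷ true ∷ [] , 3 , 5 ∷ 0 ∷ 3 ∷ 2 ∷ 1 ∷ [])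
  ∷ (false ∷ false ∷ true ∷ true ∷ false ∷ [] , 2 , 3 ∷ 5 ∷ 2 ∷ 0 ∷ 1 ∷ [])
  ∷ (false ∷ false ∷ true ∷ true ∷ true ∷ [] , 3 , 5 ∷ 0 ∷ 3 ∷ 2 ∷ 1 ∷ [])
  ∷ (false ∷ true ∷ false ∷ false ∷ false ∷ [] , 2 , 2 ∷ 5 ∷ 3 ∷ 0 ∷ 1 ∷ [])
  ∷ (false ∷ true ∷ false ∷ false ∷ true ∷ [] , 3 , 5 ∷ 0 ∷ 2 ∷ 3 ∷ 1 ∷ [])
  ∷ (false ∷ true ∷ false ∷ true ∷ false ∷ [] , 2 , 2 ∷ 5 ∷ 3 ∷ 0 ∷ 1 ∷ [])
  ∷ (false ∷ true ∷ false ∷ true ∷ true ∷ [] , 3 , 5 ∷ 0 ∷ 2 ∷ 3 ∷ 1 ∷ [])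
  ∷ (false ∷ true ∷ true ∷ false ∷ false ∷ [] , 5 , 5 ∷ 1 ∷ 4 ∷ 2 ∷ 0 ∷ [])
  ∷ (false ∷ true ∷ true ∷ false ∷ true ∷ [] , 17 , 1 ∷ 0 ∷ 2 ∷ 3 ∷ 5 ∷ [])
  ∷ (false ∷ true ∷ true ∷ true ∷ false ∷ [] , 5 , 0 ∷ 2 ∷ 3 ∷ 4 ∷ 1 ∷ [])
  ∷ (false ∷ true ∷ true ∷ true ∷ true ∷ [] , 5 , 0 ∷ 2 ∷ 3 ∷ 4 ∷ 1 ∷ [])
  ∷ (true ∷ false ∷ false ∷ false ∷ false ∷ [] , 2 , 1 ∷ 5 ∷ 4 ∷ 0 ∷ 2 ∷ [])
  ∷ (true ∷ false ∷ false ∷ false ∷ true ∷ [] , 3 , 5 ∷ 0 ∷ 1 ∷ 4 ∷ 2 ∷ [])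
  ∷ (true ∷ false ∷ false ∷ true ∷ false ∷ [] , 5 , 5 ∷ 2 ∷ 3 ∷ 1 ∷ 0 ∷ [])
  ∷ (true ∷ false ∷ false ∷ true ∷ true ∷ [] , 17 , 2 ∷ 0 ∷ 1 ∷ 4 ∷ 5 ∷ [])
  ∷ (true ∷ false ∷ true ∷ false ∷ false ∷ [] , 2 , 1 ∷ 5 ∷ 4 ∷ 0 ∷ 2 ∷ [])
  ∷ (true ∷ false ∷ true ∷ false ∷ true ∷ [] , 3 , 5 ∷ 0 ∷ 1 ∷ 4 ∷ 2 ∷ [])
  ∷ (true ∷ false ∷ true ∷ true ∷ false ∷ [] , 5 , 0 ∷ 1 ∷ 4 ∷ 3 ∷ 2 ∷ [])
  ∷ (true ∷ false ∷ true ∷ true ∷ true ∷ [] , 5 , 0 ∷ 1 ∷ 4 ∷ 3 ∷ 2 ∷ [])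
  ∷ (true ∷ true ∷ false ∷ false ∷ false ∷ [] , 2 , 1 ∷ 5 ∷ 4 ∷ 0 ∷ 3 ∷ [])
  ∷ (true ∷ true ∷ false ∷ false ∷ true ∷ [] , 3 , 5 ∷ 0 ∷ 1 ∷ 4 ∷ 3 ∷ [])
  ∷ (true ∷ true ∷ false ∷ true ∷ false ∷ [] , 5 , 0 ∷ 1 ∷ 4 ∷ 2 ∷ 3 ∷ [])
  ∷ (true ∷ true ∷ false ∷ true ∷ true ∷ [] , 5 , 0 ∷ 1 ∷ 4 ∷ 2 ∷ 3 ∷ [])
  ∷ (true ∷ true ∷ true ∷ false ∷ false ∷ [] , 5 , 0 ∷ 2 ∷ 3 ∷ 1 ∷ 4 ∷ [])
  ∷ (true ∷ true ∷ true ∷ false ∷ true ∷ [] , 5 , 0 ∷ 2 ∷ 3 ∷ 1 ∷ 4 ∷ [])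
  ∷ (true ∷ true ∷ true ∷ true ∷ false ∷ [] , 18 , 1 ∷ 2 ∷ 3 ∷ 0 ∷ 5 ∷ [])
  ∷ (true ∷ true ∷ true ∷ true ∷ true ∷ [] , 16 , 1 ∷ 2 ∷ 3 ∷ 0 ∷ 5 ∷ [])
  ∷ [])
  []

stage₉ : Stage
stage₉ = stage 3 (fromEdges 4 ((0 , 3) ∷ (1 , 2) ∷ (1 , 3) ∷ (2 , 3) ∷ [])) trianglePrism
  (# 0 ∷ # 4 ∷ # 5 ∷ # 3 ∷ [])
  []
  ( (false ∷ false ∷ false ∷ true ∷ [] , 15 , 0 ∷ 1 ∷ 2 ∷ 3 ∷ 4 ∷ [])
  ∷ (false ∷ false ∷ true ∷ false ∷ [] , 2 , 3 ∷ 4 ∷ 2 ∷ 0 ∷ 1 ∷ [])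
  ∷ (false ∷ false ∷ true ∷ true ∷ [] , 3 , 4 ∷ 0 ∷ 3 ∷ 2 ∷ 1 ∷ [])
  ∷ (false ∷ true ∷ false ∷ false ∷ [] , 2 , 2 ∷ 4 ∷ 3 ∷ 0 ∷ 1 ∷ [])
  ∷ (false ∷ true ∷ false ∷ true ∷ [] , 3 , 4 ∷ 0 ∷ 2 ∷ 3 ∷ 1 ∷ [])
  ∷ (false ∷ true ∷ true ∷ false ∷ [] , 7 , 4 ∷ 2 ∷ 3 ∷ 0 ∷ 1 ∷ [])
  ∷ (false ∷ true ∷ true ∷ true ∷ [] , 17 , 1 ∷ 0 ∷ 2 ∷ 3 ∷ 4 ∷ [])
  ∷ (true ∷ false ∷ false ∷ false ∷ [] , 5 , 4 ∷ 2 ∷ 3 ∷ 1 ∷ 0 ∷ [])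
  ∷ (true ∷ false ∷ false ∷ true ∷ [] , 22 , 0 ∷ 2 ∷ 3 ∷ 1 ∷ 4 ∷ [])
  ∷ (true ∷ false ∷ true ∷ false ∷ [] , 14 , 2 ∷ 0 ∷ 1 ∷ 4 ∷ 3 ∷ [])
  ∷ (true ∷ false ∷ true ∷ true ∷ [] , 6 , 4 ∷ 1 ∷ 0 ∷ 3 ∷ 2 ∷ [])
  ∷ (true ∷ true ∷ false ∷ false ∷ [] , 14 , 3 ∷ 0 ∷ 1 ∷ 4 ∷ 2 ∷ [])
  ∷ (true ∷ true ∷ false ∷ true ∷ [] , 6 , 4 ∷ 1 ∷ 0 ∷ 2 ∷ 3 ∷ [])
  ∷ (true ∷ true ∷ true ∷ false ∷ [] , 18 , 1 ∷ 2 ∷ 3 ∷ 0 ∷ 4 ∷ [])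
  ∷ (true ∷ true ∷ true ∷ true ∷ [] , 16 , 1 ∷ 2 ∷ 3 ∷ 0 ∷ 4 ∷ [])
  ∷ [])
  []

stage₁₀ : Stage
stage₁₀ = stage 3 (fromEdges 4 ((0 , 3) ∷ (1 , 2) ∷ (2 , 3) ∷ [])) pentagon
  (# 0 ∷ # 2 ∷ # 3 ∷ # 4 ∷ [])
  []
  ( (false ∷ false ∷ false ∷ true ∷ [] , 0 , 4 ∷ 0 ∷ 1 ∷ 3 ∷ 2 ∷ [])
  ∷ (false ∷ false ∷ true ∷ false ∷ [] , 0 , 3 ∷ 0 ∷ 2 ∷ 4 ∷ 1 ∷ [])
  ∷ (false ∷ false ∷ true ∷ true ∷ [] , 2 , 3 ∷ 4 ∷ 0 ∷ 2 ∷ 1 ∷ [])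
  ∷ (false ∷ true ∷ false ∷ false ∷ [] , 4 , 0 ∷ 2 ∷ 3 ∷ 4 ∷ 1 ∷ [])
  ∷ (false ∷ true ∷ false ∷ true ∷ [] , 1 , 4 ∷ 0 ∷ 2 ∷ 3 ∷ 1 ∷ [])
  ∷ (false ∷ true ∷ true ∷ false ∷ [] , 5 , 3 ∷ 0 ∷ 2 ∷ 4 ∷ 1 ∷ [])
  ∷ (false ∷ true ∷ true ∷ true ∷ [] , 7 , 4 ∷ 0 ∷ 3 ∷ 2 ∷ 1 ∷ [])
  ∷ (true ∷ false ∷ false ∷ false ∷ [] , 4 , 0 ∷ 1 ∷ 4 ∷ 3 ∷ 2 ∷ [])
  ∷ (true ∷ false ∷ false ∷ true ∷ [] , 5 , 4 ∷ 0 ∷ 1 ∷ 3 ∷ 2 ∷ [])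
  ∷ (true ∷ false ∷ true ∷ false ∷ [] , 1 , 3 ∷ 0 ∷ 1 ∷ 4 ∷ 2 ∷ [])
  ∷ (true ∷ false ∷ true ∷ true ∷ [] , 7 , 3 ∷ 0 ∷ 4 ∷ 1 ∷ 2 ∷ [])
  ∷ (true ∷ true ∷ false ∷ false ∷ [] , 19 , 0 ∷ 3 ∷ 4 ∷ 1 ∷ 2 ∷ [])
  ∷ (true ∷ true ∷ false ∷ true ∷ [] , 14 , 1 ∷ 2 ∷ 3 ∷ 4 ∷ 0 ∷ [])
  ∷ (true ∷ true ∷ true ∷ false ∷ [] , 14 , 2 ∷ 1 ∷ 4 ∷ 3 ∷ 0 ∷ [])
  ∷ (true ∷ true ∷ true ∷ true ∷ [] , 6 , 0 ∷ 1 ∷ 4 ∷ 3 ∷ 2 ∷ [])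
  ∷ [])
  []

stage₁₁ : Stage
stage₁₁ = stage 3 (fromEdges 4 ((0 , 2) ∷ (0 , 3) ∷ (1 , 2) ∷ (1 , 3) ∷ [])) trianglePrism
  (# 0 ∷ # 4 ∷ # 1 ∷ # 3 ∷ [])
  []
  ( (false ∷ false ∷ false ∷ true ∷ [] , 1 , 4 ∷ 1 ∷ 3 ∷ 2 ∷ 0 ∷ [])
  ∷ (false ∷ false ∷ true ∷ false ∷ [] , 1 , 3 ∷ 1 ∷ 4 ∷ 2 ∷ 0 ∷ [])
  ∷ (false ∷ false ∷ true ∷ true ∷ [] , 21 , 0 ∷ 1 ∷ 2 ∷ 3 ∷ 4 ∷ [])
  ∷ (false ∷ true ∷ false ∷ false ∷ [] , 1 , 2 ∷ 3 ∷ 1 ∷ 4 ∷ 0 ∷ [])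
  ∷ (false ∷ true ∷ false ∷ true ∷ [] , 14 , 0 ∷ 1 ∷ 3 ∷ 2 ∷ 4 ∷ [])
  ∷ (false ∷ true ∷ true ∷ false ∷ [] , 14 , 0 ∷ 1 ∷ 4 ∷ 2 ∷ 3 ∷ [])
  ∷ (false ∷ true ∷ true ∷ true ∷ [] , 18 , 1 ∷ 0 ∷ 2 ∷ 3 ∷ 4 ∷ [])
  ∷ (true ∷ false ∷ false ∷ false ∷ [] , 1 , 1 ∷ 3 ∷ 2 ∷ 4 ∷ 0 ∷ [])
  ∷ (true ∷ false ∷ false ∷ true ∷ [] , 14 , 0 ∷ 2 ∷ 3 ∷ 1 ∷ 4 ∷ [])
  ∷ (true ∷ false ∷ true ∷ false ∷ [] , 14 , 0 ∷ 2 ∷ 4 ∷ 1 ∷ 3 ∷ [])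
  ∷ (true ∷ false ∷ true ∷ true ∷ [] , 18 , 2 ∷ 0 ∷ 1 ∷ 3 ∷ 4 ∷ [])
  ∷ (true ∷ true ∷ false ∷ false ∷ [] , 21 , 0 ∷ 3 ∷ 4 ∷ 1 ∷ 2 ∷ [])
  ∷ (true ∷ true ∷ false ∷ true ∷ [] , 18 , 3 ∷ 0 ∷ 4 ∷ 1 ∷ 2 ∷ [])
  ∷ (true ∷ true ∷ true ∷ false ∷ [] , 18 , 4 ∷ 0 ∷ 3 ∷ 1 ∷ 2 ∷ [])
  ∷ (true ∷ true ∷ true ∷ true ∷ [] , 20 , 1 ∷ 2 ∷ 3 ∷ 4 ∷ 0 ∷ [])
  ∷ [])
  []

stage₁₂ : Stage
stage₁₂ = stage 5 (fromEdges 6 ((0 , 1) ∷ (0 , 2) ∷ (0 , 3) ∷ (1 , 2) ∷ (1 , 3) ∷ (2 , 3) ∷ (0 , 4) ∷ (0 , 5) ∷ (1 , 4) ∷ (1 , 5) ∷ (2 , 4) ∷ (2 , 5) ∷ (3 , 4) ∷ (3 , 5) ∷ [])) starBlowup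
  (# 0 ∷ # 0 ∷ # 0 ∷ # 0 ∷ # 1 ∷ # 2 ∷ [])
  ( (true ∷ true ∷ true ∷ true ∷ false ∷ false ∷ [] , # 3)
  ∷ (true ∷ true ∷ true ∷ true ∷ true ∷ true ∷ [] , # 0)
  ∷ [])
  ( (false ∷ false ∷ false ∷ false ∷ false ∷ true ∷ [] , 7 , 6 ∷ 1 ∷ 2 ∷ 5 ∷ 0 ∷ [])
  ∷ (false ∷ false ∷ false ∷ false ∷ true ∷ false ∷ [] , 7 , 5 ∷ 1 ∷ 2 ∷ 6 ∷ 0 ∷ [])
  ∷ (false ∷ false ∷ false ∷ false ∷ true ∷ true ∷ [] , 17 , 0 ∷ 1 ∷ 2 ∷ 3 ∷ 5 ∷ [])
  ∷ (false ∷ false ∷ false ∷ true ∷ false ∷ false ∷ [] , 3 , 4 ∷ 5 ∷ 1 ∷ 6 ∷ 0 ∷ [])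
  ∷ (false ∷ false ∷ false ∷ true ∷ false ∷ true ∷ [] , 6 , 4 ∷ 0 ∷ 6 ∷ 1 ∷ 5 ∷ [])
  ∷ (false ∷ false ∷ false ∷ true ∷ true ∷ false ∷ [] , 6 , 4 ∷ 0 ∷ 5 ∷ 1 ∷ 6 ∷ [])
  ∷ (false ∷ false ∷ false ∷ true ∷ true ∷ true ∷ [] , 11 , 5 ∷ 4 ∷ 6 ∷ 1 ∷ 2 ∷ 0 ∷ [])
  ∷ (false ∷ false ∷ true ∷ false ∷ false ∷ false ∷ [] , 3 , 3 ∷ 5 ∷ 1 ∷ 6 ∷ 0 ∷ [])
  ∷ (false ∷ false ∷ true ∷ false ∷ false ∷ true ∷ [] , 6 , 3 ∷ 0 ∷ 6 ∷ 1 ∷ 5 ∷ [])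
  ∷ (false ∷ false ∷ true ∷ false ∷ true ∷ false ∷ [] , 6 , 3 ∷ 0 ∷ 5 ∷ 1 ∷ 6 ∷ [])
  ∷ (false ∷ false ∷ true ∷ false ∷ true ∷ true ∷ [] , 11 , 5 ∷ 3 ∷ 6 ∷ 1 ∷ 2 ∷ 0 ∷ [])
  ∷ (false ∷ false ∷ true ∷ true ∷ false ∷ false ∷ [] , 3 , 3 ∷ 5 ∷ 1 ∷ 6 ∷ 0 ∷ [])
  ∷ (false ∷ false ∷ true ∷ true ∷ false ∷ true ∷ [] , 6 , 3 ∷ 0 ∷ 6 ∷ 1 ∷ 5 ∷ [])
  ∷ (false ∷ false ∷ true ∷ true ∷ true ∷ false ∷ [] , 6 , 3 ∷ 0 ∷ 5 ∷ 1 ∷ 6 ∷ [])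
  ∷ (false ∷ false ∷ true ∷ true ∷ true ∷ true ∷ [] , 11 , 5 ∷ 3 ∷ 6 ∷ 1 ∷ 2 ∷ 0 ∷ [])
  ∷ (false ∷ true ∷ false ∷ false ∷ false ∷ false ∷ [] , 3 , 2 ∷ 5 ∷ 1 ∷ 6 ∷ 0 ∷ [])
  ∷ (false ∷ true ∷ false ∷ false ∷ false ∷ true ∷ [] , 6 , 2 ∷ 0 ∷ 6 ∷ 1 ∷ 5 ∷ [])
  ∷ (false ∷ true ∷ false ∷ false ∷ true ∷ false ∷ [] , 6 , 2 ∷ 0 ∷ 5 ∷ 1 ∷ 6 ∷ [])
  ∷ (false ∷ true ∷ false ∷ false ∷ true ∷ true ∷ [] , 11 , 5 ∷ 2 ∷ 6 ∷ 1 ∷ 3 ∷ 0 ∷ [])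
  ∷ (false ∷ true ∷ false ∷ true ∷ false ∷ false ∷ [] , 3 , 2 ∷ 5 ∷ 1 ∷ 6 ∷ 0 ∷ [])
  ∷ (false ∷ true ∷ false ∷ true ∷ false ∷ true ∷ [] , 6 , 2 ∷ 0 ∷ 6 ∷ 1 ∷ 5 ∷ [])
  ∷ (false ∷ true ∷ false ∷ true ∷ true ∷ false ∷ [] , 6 , 2 ∷ 0 ∷ 5 ∷ 1 ∷ 6 ∷ [])
  ∷ (false ∷ true ∷ false ∷ true ∷ true ∷ true ∷ [] , 11 , 5 ∷ 2 ∷ 6 ∷ 1 ∷ 3 ∷ 0 ∷ [])
  ∷ (false ∷ true ∷ true ∷ false ∷ false ∷ false ∷ [] , 3 , 2 ∷ 5 ∷ 1 ∷ 6 ∷ 0 ∷ [])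
  ∷ (false ∷ true ∷ true ∷ false ∷ false ∷ true ∷ [] , 6 , 2 ∷ 0 ∷ 6 ∷ 1 ∷ 5 ∷ [])
  ∷ (false ∷ true ∷ true ∷ false ∷ true ∷ false ∷ [] , 6 , 2 ∷ 0 ∷ 5 ∷ 1 ∷ 6 ∷ [])
  ∷ (false ∷ true ∷ true ∷ false ∷ true ∷ true ∷ [] , 11 , 5 ∷ 2 ∷ 6 ∷ 1 ∷ 4 ∷ 0 ∷ [])
  ∷ (false ∷ true ∷ true ∷ true ∷ false ∷ false ∷ [] , 3 , 2 ∷ 5 ∷ 1 ∷ 6 ∷ 0 ∷ [])
  ∷ (false ∷ true ∷ true ∷ true ∷ false ∷ true ∷ [] , 6 , 2 ∷ 0 ∷ 6 ∷ 1 ∷ 5 ∷ [])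
  ∷ (false ∷ true ∷ true ∷ true ∷ true ∷ false ∷ [] , 6 , 2 ∷ 0 ∷ 5 ∷ 1 ∷ 6 ∷ [])
  ∷ (false ∷ true ∷ true ∷ true ∷ true ∷ true ∷ [] , 12 , 2 ∷ 3 ∷ 4 ∷ 0 ∷ 5 ∷ 1 ∷ 6 ∷ [])
  ∷ (true ∷ false ∷ false ∷ false ∷ false ∷ false ∷ [] , 3 , 1 ∷ 5 ∷ 2 ∷ 6 ∷ 0 ∷ [])
  ∷ (true ∷ false ∷ false ∷ false ∷ false ∷ true ∷ [] , 6 , 1 ∷ 0 ∷ 6 ∷ 2 ∷ 5 ∷ [])
  ∷ (true ∷ false ∷ false ∷ false ∷ true ∷ false ∷ [] , 6 , 1 ∷ 0 ∷ 5 ∷ 2 ∷ 6 ∷ [])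
  ∷ (true ∷ false ∷ false ∷ false ∷ true ∷ true ∷ [] , 11 , 5 ∷ 1 ∷ 6 ∷ 2 ∷ 3 ∷ 0 ∷ [])
  ∷ (true ∷ false ∷ false ∷ true ∷ false ∷ false ∷ [] , 3 , 1 ∷ 5 ∷ 2 ∷ 6 ∷ 0 ∷ [])
  ∷ (true ∷ false ∷ false ∷ true ∷ false ∷ true ∷ [] , 6 , 1 ∷ 0 ∷ 6 ∷ 2 ∷ 5 ∷ [])
  ∷ (true ∷ false ∷ false ∷ true ∷ true ∷ false ∷ [] , 6 , 1 ∷ 0 ∷ 5 ∷ 2 ∷ 6 ∷ [])
  ∷ (true ∷ false ∷ false ∷ true ∷ true ∷ true ∷ [] , 11 , 5 ∷ 1 ∷ 6 ∷ 2 ∷ 3 ∷ 0 ∷ [])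
  ∷ (true ∷ false ∷ true ∷ false ∷ false ∷ false ∷ [] , 3 , 1 ∷ 5 ∷ 2 ∷ 6 ∷ 0 ∷ [])
  ∷ (true ∷ false ∷ true ∷ false ∷ false ∷ true ∷ [] , 6 , 1 ∷ 0 ∷ 6 ∷ 2 ∷ 5 ∷ [])
  ∷ (true ∷ false ∷ true ∷ false ∷ true ∷ false ∷ [] , 6 , 1 ∷ 0 ∷ 5 ∷ 2 ∷ 6 ∷ [])
  ∷ (true ∷ false ∷ true ∷ false ∷ true ∷ true ∷ [] , 11 , 5 ∷ 1 ∷ 6 ∷ 2 ∷ 4 ∷ 0 ∷ [])
  ∷ (true ∷ false ∷ true ∷ true ∷ false ∷ false ∷ [] , 3 , 1 ∷ 5 ∷ 2 ∷ 6 ∷ 0 ∷ [])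
  ∷ (true ∷ false ∷ true ∷ true ∷ false ∷ true ∷ [] , 6 , 1 ∷ 0 ∷ 6 ∷ 2 ∷ 5 ∷ [])
  ∷ (true ∷ false ∷ true ∷ true ∷ true ∷ false ∷ [] , 6 , 1 ∷ 0 ∷ 5 ∷ 2 ∷ 6 ∷ [])
  ∷ (true ∷ false ∷ true ∷ true ∷ true ∷ true ∷ [] , 12 , 1 ∷ 3 ∷ 4 ∷ 0 ∷ 5 ∷ 2 ∷ 6 ∷ [])
  ∷ (true ∷ true ∷ false ∷ false ∷ false ∷ false ∷ [] , 3 , 1 ∷ 5 ∷ 3 ∷ 6 ∷ 0 ∷ [])
  ∷ (true ∷ true ∷ false ∷ false ∷ false ∷ true ∷ [] , 6 , 1 ∷ 0 ∷ 6 ∷ 3 ∷ 5 ∷ [])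
  ∷ (true ∷ true ∷ false ∷ false ∷ true ∷ false ∷ [] , 6 , 1 ∷ 0 ∷ 5 ∷ 3 ∷ 6 ∷ [])
  ∷ (true ∷ true ∷ false ∷ false ∷ true ∷ true ∷ [] , 11 , 5 ∷ 1 ∷ 6 ∷ 3 ∷ 4 ∷ 0 ∷ [])
  ∷ (true ∷ true ∷ false ∷ true ∷ false ∷ false ∷ [] , 3 , 1 ∷ 5 ∷ 3 ∷ 6 ∷ 0 ∷ [])
  ∷ (true ∷ true ∷ false ∷ true ∷ false ∷ true ∷ [] , 6 , 1 ∷ 0 ∷ 6 ∷ 3 ∷ 5 ∷ [])
  ∷ (true ∷ true ∷ false ∷ true ∷ true ∷ false ∷ [] , 6 , 1 ∷ 0 ∷ 5 ∷ 3 ∷ 6 ∷ [])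
  ∷ (true ∷ true ∷ false ∷ true ∷ true ∷ true ∷ [] , 12 , 1 ∷ 2 ∷ 4 ∷ 0 ∷ 5 ∷ 3 ∷ 6 ∷ [])
  ∷ (true ∷ true ∷ true ∷ false ∷ false ∷ false ∷ [] , 3 , 1 ∷ 5 ∷ 4 ∷ 6 ∷ 0 ∷ [])
  ∷ (true ∷ true ∷ true ∷ false ∷ false ∷ true ∷ [] , 6 , 1 ∷ 0 ∷ 6 ∷ 4 ∷ 5 ∷ [])
  ∷ (true ∷ true ∷ true ∷ false ∷ true ∷ false ∷ [] , 6 , 1 ∷ 0 ∷ 5 ∷ 4 ∷ 6 ∷ [])
  ∷ (true ∷ true ∷ true ∷ false ∷ true ∷ true ∷ [] , 12 , 1 ∷ 2 ∷ 3 ∷ 0 ∷ 5 ∷ 4 ∷ 6 ∷ [])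
  ∷ (true ∷ true ∷ true ∷ true ∷ false ∷ true ∷ [] , 16 , 5 ∷ 0 ∷ 6 ∷ 1 ∷ 2 ∷ [])
  ∷ (true ∷ true ∷ true ∷ true ∷ true ∷ false ∷ [] , 16 , 6 ∷ 0 ∷ 5 ∷ 1 ∷ 2 ∷ [])
  ∷ [])
  ( (true ∷ true ∷ true ∷ true ∷ true ∷ false ∷ false ∷ false ∷ false ∷ false ∷ false ∷ false ∷ false ∷ [] , 0 , 2 ∷ 6 ∷ 7 ∷ 0 ∷ 1 ∷ [])
  ∷ (true ∷ true ∷ true ∷ true ∷ true ∷ true ∷ true ∷ false ∷ false ∷ false ∷ false ∷ false ∷ false ∷ [] , 3 , 0 ∷ 6 ∷ 2 ∷ 7 ∷ 1 ∷ [])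
  ∷ (true ∷ true ∷ true ∷ true ∷ true ∷ false ∷ false ∷ true ∷ true ∷ true ∷ true ∷ false ∷ false ∷ [] , 15 , 6 ∷ 7 ∷ 0 ∷ 1 ∷ 2 ∷ [])
  ∷ (false ∷ true ∷ true ∷ true ∷ true ∷ false ∷ false ∷ true ∷ true ∷ true ∷ true ∷ false ∷ false ∷ [] , 13 , 2 ∷ 3 ∷ 4 ∷ 5 ∷ 0 ∷ 1 ∷ 6 ∷ 7 ∷ [])
  ∷ (false ∷ true ∷ true ∷ true ∷ true ∷ false ∷ false ∷ true ∷ true ∷ true ∷ true ∷ true ∷ true ∷ [] , 3 , 2 ∷ 6 ∷ 1 ∷ 7 ∷ 0 ∷ [])
  ∷ (false ∷ true ∷ true ∷ true ∷ true ∷ true ∷ true ∷ true ∷ true ∷ true ∷ true ∷ false ∷ false ∷ [] , 3 , 2 ∷ 6 ∷ 0 ∷ 7 ∷ 1 ∷ [])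
  ∷ (false ∷ true ∷ true ∷ true ∷ true ∷ true ∷ true ∷ true ∷ true ∷ true ∷ true ∷ true ∷ true ∷ [] , 12 , 2 ∷ 3 ∷ 4 ∷ 0 ∷ 6 ∷ 1 ∷ 7 ∷ [])
  ∷ [])

stage₁₃ : Stage
stage₁₃ = stage 3 (fromEdges 4 ((0 , 1) ∷ (0 , 2) ∷ (0 , 3) ∷ (1 , 2) ∷ (1 , 3) ∷ [])) multipartite
  (# 0 ∷ # 1 ∷ # 2 ∷ # 2 ∷ [])
  ( (true ∷ true ∷ false ∷ false ∷ [] , # 2)
  ∷ (true ∷ true ∷ true ∷ true ∷ [] , # 3)
  ∷ [])
  ( (false ∷ false ∷ false ∷ true ∷ [] , 7 , 4 ∷ 1 ∷ 2 ∷ 3 ∷ 0 ∷ [])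
  ∷ (false ∷ false ∷ true ∷ false ∷ [] , 7 , 3 ∷ 1 ∷ 2 ∷ 4 ∷ 0 ∷ [])
  ∷ (false ∷ false ∷ true ∷ true ∷ [] , 18 , 0 ∷ 1 ∷ 2 ∷ 3 ∷ 4 ∷ [])
  ∷ (false ∷ true ∷ false ∷ false ∷ [] , 3 , 2 ∷ 3 ∷ 1 ∷ 4 ∷ 0 ∷ [])
  ∷ (false ∷ true ∷ false ∷ true ∷ [] , 6 , 2 ∷ 0 ∷ 4 ∷ 1 ∷ 3 ∷ [])
  ∷ (false ∷ true ∷ true ∷ false ∷ [] , 6 , 2 ∷ 0 ∷ 3 ∷ 1 ∷ 4 ∷ [])
  ∷ (false ∷ true ∷ true ∷ true ∷ [] , 20 , 0 ∷ 1 ∷ 3 ∷ 4 ∷ 2 ∷ [])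
  ∷ (true ∷ false ∷ false ∷ false ∷ [] , 3 , 1 ∷ 3 ∷ 2 ∷ 4 ∷ 0 ∷ [])
  ∷ (true ∷ false ∷ false ∷ true ∷ [] , 6 , 1 ∷ 0 ∷ 4 ∷ 2 ∷ 3 ∷ [])
  ∷ (true ∷ false ∷ true ∷ false ∷ [] , 6 , 1 ∷ 0 ∷ 3 ∷ 2 ∷ 4 ∷ [])
  ∷ (true ∷ false ∷ true ∷ true ∷ [] , 20 , 0 ∷ 2 ∷ 3 ∷ 4 ∷ 1 ∷ [])
  ∷ (true ∷ true ∷ false ∷ true ∷ [] , 16 , 3 ∷ 0 ∷ 4 ∷ 1 ∷ 2 ∷ [])
  ∷ (true ∷ true ∷ true ∷ false ∷ [] , 16 , 4 ∷ 0 ∷ 3 ∷ 1 ∷ 2 ∷ [])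
  ∷ [])
  ( (true ∷ true ∷ true ∷ false ∷ false ∷ false ∷ false ∷ false ∷ false ∷ [] , 0 , 2 ∷ 4 ∷ 5 ∷ 0 ∷ 1 ∷ [])
  ∷ (true ∷ true ∷ true ∷ true ∷ true ∷ false ∷ false ∷ false ∷ false ∷ [] , 3 , 0 ∷ 4 ∷ 2 ∷ 5 ∷ 1 ∷ [])
  ∷ (true ∷ true ∷ true ∷ false ∷ false ∷ true ∷ true ∷ false ∷ false ∷ [] , 15 , 4 ∷ 5 ∷ 0 ∷ 1 ∷ 2 ∷ [])
  ∷ (false ∷ true ∷ true ∷ false ∷ false ∷ true ∷ true ∷ true ∷ true ∷ [] , 3 , 2 ∷ 4 ∷ 1 ∷ 5 ∷ 0 ∷ [])
  ∷ (false ∷ true ∷ true ∷ true ∷ true ∷ true ∷ true ∷ false ∷ false ∷ [] , 3 , 2 ∷ 4 ∷ 0 ∷ 5 ∷ 1 ∷ [])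
  ∷ (true ∷ true ∷ true ∷ true ∷ true ∷ true ∷ true ∷ true ∷ true ∷ [] , 26 , 0 ∷ 1 ∷ 2 ∷ 3 ∷ 4 ∷ 5 ∷ [])
  ∷ (false ∷ true ∷ true ∷ true ∷ true ∷ true ∷ true ∷ true ∷ true ∷ [] , 20 , 0 ∷ 1 ∷ 4 ∷ 5 ∷ 2 ∷ [])
  ∷ [])

stage₁₄ : Stage
stage₁₄ = stage 2 (fromEdges 3 ((0 , 1) ∷ (0 , 2) ∷ [])) multipartite
  (# 0 ∷ # 1 ∷ # 1 ∷ [])
  ( (true ∷ false ∷ false ∷ [] , # 1)
  ∷ [])
  ( (false ∷ false ∷ true ∷ [] , 24 , 0 ∷ 2 ∷ 1 ∷ 3 ∷ [])
  ∷ (false ∷ true ∷ false ∷ [] , 24 , 0 ∷ 3 ∷ 1 ∷ 2 ∷ [])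
  ∷ (false ∷ true ∷ true ∷ [] , 25 , 0 ∷ 1 ∷ 2 ∷ 3 ∷ [])
  ∷ (true ∷ false ∷ true ∷ [] , 23 , 2 ∷ 0 ∷ 3 ∷ 1 ∷ [])
  ∷ (true ∷ true ∷ false ∷ [] , 23 , 3 ∷ 0 ∷ 2 ∷ 1 ∷ [])
  ∷ (true ∷ true ∷ true ∷ [] , 27 , 0 ∷ 1 ∷ 2 ∷ 3 ∷ [])
  ∷ [])
  ( (true ∷ true ∷ false ∷ false ∷ false ∷ false ∷ false ∷ [] , 0 , 2 ∷ 3 ∷ 4 ∷ 0 ∷ 1 ∷ [])
  ∷ (true ∷ true ∷ false ∷ false ∷ true ∷ false ∷ false ∷ [] , 15 , 3 ∷ 4 ∷ 0 ∷ 1 ∷ 2 ∷ [])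
  ∷ [])

stage₁₅ : Stage
stage₁₅ = stage 0 (fromEdges 1 ([])) cycleBlowup
  (# 0 ∷ [])
  ( (true ∷ [] , # 0)
  ∷ [])
  []
  ( (true ∷ true ∷ false ∷ [] , 28 , 0 ∷ 1 ∷ 2 ∷ [])
  ∷ (false ∷ true ∷ true ∷ [] , 28 , 2 ∷ 0 ∷ 1 ∷ [])
  ∷ [])

stages : List Stage
stages = stage₀ ∷ stage₁ ∷ stage₂ ∷ stage₃ ∷ stage₄ ∷ stage₅ ∷ stage₆ ∷ stage₇
       ∷ stage₈ ∷ stage₉ ∷ stage₁₀ ∷ stage₁₁ ∷ stage₁₂ ∷ stage₁₃ ∷ stage₁₄ ∷ stage₁₅ ∷ []

mainTheorem2 : {n : ℕ} (G : SimpleGraph n) → Connected (adj G) →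
    ((∀ H → H ∈ 𝓕 → ¬ (proj₂ H ⊑ᵢ adj G))
     ⇔ (adj G ⊑ᵢ C5
        ⊎ adj G ⊑ᵢ prism
        ⊎ (Σ (Fin 4 → ℕ) λ s → (∀ i → 1 ≤ s i) × (adj G ⊑ᵢ CompleteMultipartite 4 s))
        ⊎ (Σ (Fin 4 → ℤ) λ r → (∀ i → r i < 0ℤ) × (adj G ⊑ᵢ Blowup C4 r))
        ⊎ (Σ (Fin 4 → ℤ) λ r → (∀ i → r i < 0ℤ) × (adj G ⊑ᵢ Blowup S4 r))))
mainTheorem2 {zero} G _ = mk⇔ (λ _ → inj₁ ((λ ()) , (λ { {()} }) , λ ())) InSomeTarget⇒Free
mainTheorem2 {suc m} G connected = mk⇔ (toTarget ∘ classify G connected 𝓕 stages _) InSomeTarget⇒Free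
  where
  toTarget : Classified G → InSomeTarget (adj G)
  toTarget (t , _ , model) = InTarget⇒InSomeTarget t (Model⇒InTarget t G model)
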